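{- Let $a$ be a positive integer, $n\ge0$ and $\pi\in\mathfrak{S}_n$. Then $$\mathrm{Prob}_{\Psi_a}(\pi)=\mathrm{Prob}_a(\pi^{ -1})=F_{D(\pi)}\big(\tfrac1a,\dots,\tfrac1a,0,0,\dots\big),$$ where in the last expression the first $a$ variables are set to $1/a$ and all others to $0$ (this is the $QS$-distribution value $\mathrm{Prob}_{QS}(\pi^{ -1})$ for $r_1=\dots=r_a=1/a$, $r_i=0$ for $i>a$).
   Context: Work over $\mathbb{Q}$ (or $\mathbb{R}$). Compositions $\alpha=(a_1,\dots,a_k)$ of $n$, $\operatorname{Comp}(n)$, $(n)$, $S_\alpha=\{a_1,\dots,a_1+\dots+a_{k-1}\}$, $\operatorname{co}$ its inverse, $\alpha\le\beta$ iff $S_\alpha\subseteq S_\beta$. $M_\alpha=\sum_{i_1<\dots<i_k}x_{i_1}^{a_1}\cdots x_{i_k}^{a_k}$; $\mathcal{Q}$ the graded Hopf algebra of quasisymmetric functions, coproduct $\Delta(M_\alpha)=\sum_{\alpha=\beta\cdot\gamma}M_\beta\otimes M_\gamma$; $F_\alpha=\sum_{\beta\ge\alpha}M_\beta$. $\mathrm{End}(\mathcal{Q})$ = graded Hopf algebra endomorphisms. For $\sigma\in\mathfrak{S}_n$, $D(\sigma)=\operatorname{co}(\{i:\sigma_i>\sigma_{i+1}\})$ and $d(\sigma)=\#\{i:\sigma_i>\sigma_{i+1}\}$. For $\Phi\in\mathrm{End}(\mathcal{Q})$ define $c_{\alpha,\beta}$ by $\Phi(F_\alpha)=\sum_\beta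 c_{\alpha,\beta}F_\beta$ and (when the $c_{\alpha,(n)}$ are nonnegative, not all zero) $\mathrm{Prob}_\Phi(\pi)=c_{D(\pi),(n)}/\sum_\sigma c_{D(\sigma),(n)}$. Let $\zeta:\mathcal{Q}\to\mathbb{Q}$ be $\zeta(G)=G(1,0,0,\dots)$, and $\zeta^{*a}=(\zeta\otimes\dots\otimes\zeta)\circ\Delta^{(a)}$ its $a$-th convolution power ($\Delta^{(a)}$ the $(a-1)$-fold iterated coproduct). $\Psi_a$ is the unique $\Phi\in\mathrm{End}(\mathcal{Q})$ with $\Phi(G)(1,0,0,\dots)=\zeta^{*a}(G)$ for all $G\in\mathcal{Q}$. The $a$-shuffle distribution is $\mathrm{Prob}_a(\sigma)=\binom{n+a-d(\sigma^{ -1})-1}{n}/a^n$. -}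

module Defs where

open import Data.Bool using (Bool; true; false; if_then_else_; _∧_; _∨_)
open import Data.Nat as ℕ using (ℕ; zero; suc; _∸_; _≡ᵇ_; _<ᵇ_; NonZero)
open import Data.Nat.Properties using (m^n≢0)
open import Data.Nat.Combinatorics using (_C_)
open import Data.Integer using (+_)
open import Data.List using (List; []; _∷_; map; concatMap; _++_; foldr; upTo; filterᵇ; length; replicate)
open import Data.Nat.ListAction using (sum)
open import Data.Bool.ListAction using (all; any)
open import Data.List.Relation.Unary.All using (All)
open import Data.Product using (_×_; _,_; proj₁; proj₂)
open import Data.Rational as ℚ using (ℚ; 0ℚ; 1ℚ)
open import Relation.Binary.PropositionalEquality using (_≡_)

sumℚ : List ℚ → ℚ
sumℚ = foldr ℚ._+_ 0ℚ

_==_ : List ℕ → List ℕ → Bool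
[] == [] = true
[] == (_ ∷ _) = false
(_ ∷ _) == [] = false
(x ∷ xs) == (y ∷ ys) = (x ≡ᵇ y) ∧ (xs == ys)

IsComp : List ℕ → Set
IsComp α = All (λ k → 0 ℕ.< k) α

size : List ℕ → ℕ
size = sum

sublists : {A : Set} → List A → List (List A)
sublists [] = [] ∷ []
sublists (x ∷ xs) = map (x ∷_) (sublists xs) ++ sublists xs

-- co : the composition of n corresponding to an (increasing) subset
-- S = {s₁ < … < s_k} of [n-1] : (s₁, s₂ - s₁, …, n - s_k).  co 0 ∅ = ().
co : ℕ → List ℕ → List ℕ
co zero S = []
co (suc m) S = go 0 S
  where
  go : ℕ → List ℕ → List ℕ
  go p [] = (suc m ∸ p) ∷ []
  go p (s ∷ ss) = (s ∸ p) ∷ go s ss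

comps : ℕ → List (List ℕ)
comps n = map (co n) (sublists (map suc (upTo (n ∸ 1))))

-- the one-part composition (n) (the empty composition when n = 0)
single : ℕ → List ℕ
single n = co n []

psums : List ℕ → List ℕ
psums [] = []
psums (x ∷ []) = []
psums (x ∷ y ∷ ys) = x ∷ map (x ℕ.+_) (psums (y ∷ ys))

-- α ≤ β  iff  S_α ⊆ S_β
leq : List ℕ → List ℕ → Bool
leq α β = all (λ s → any (s ≡ᵇ_) (psums β)) (psums α)

-- Elements of 𝒬 : finite ℚ-linear combinations of monomial
-- quasisymmetric functions M_α, written as lists (coefficient , α).

Elt : Set
Elt = List (ℚ × List ℕ)

-- elements of 𝒬 ⊗ 𝒬 : combinations of M_β ⊗ M_γ
Elt2 : Set
Elt2 = List (ℚ × List ℕ × List ℕ)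

M : List ℕ → Elt
M α = (1ℚ , α) ∷ []

coeff : List ℕ → Elt → ℚ
coeff β v = sumℚ (map (λ p → if proj₂ p == β then proj₁ p else 0ℚ) v)

coeff2 : List ℕ → List ℕ → Elt2 → ℚ
coeff2 β γ v =
  sumℚ (map (λ p → if (proj₁ (proj₂ p) == β) ∧ (proj₂ (proj₂ p) == γ) then proj₁ p else 0ℚ) v)

scale : ℚ → Elt → Elt
scale q = map (λ p → (q ℚ.* proj₁ p , proj₂ p))

lin : (List ℕ → Elt) → Elt → Elt
lin f v = concatMap (λ p → scale (proj₁ p) (f (proj₂ p))) v

-- quasi-shuffles (with multiplicity): M_α M_β = Σ_{γ ∈ qsh α β} M_γ
qsh : List ℕ → List ℕ → List (List ℕ)
qsh [] β = β ∷ []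
qsh (x ∷ α) [] = (x ∷ α) ∷ []
qsh (x ∷ α) (y ∷ β) =
  map (x ∷_) (qsh α (y ∷ β)) ++ map (y ∷_) (qsh (x ∷ α) β) ++ map ((x ℕ.+ y) ∷_) (qsh α β)

mul : Elt → Elt → Elt
mul u v = concatMap (λ p → concatMap (λ q →
            map (λ γ → (proj₁ p ℚ.* proj₁ q , γ)) (qsh (proj₂ p) (proj₂ q))) v) u

splits : List ℕ → List (List ℕ × List ℕ)
splits [] = ([] , []) ∷ []
splits (x ∷ xs) = ([] , x ∷ xs) ∷ map (λ p → (x ∷ proj₁ p , proj₂ p)) (splits xs)

Δ : Elt → Elt2
Δ v = concatMap (λ p → map (λ s → (proj₁ p , proj₁ s , proj₂ s)) (splits (proj₂ p))) v

-- Graded linear endomorphisms of 𝒬 are given by their matrices in the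
-- M-basis:  Φ(M_α) = Σ_{β ∈ Comp(|α|)} Φ α β · M_β  (gradedness built in).

Mat : Set
Mat = List ℕ → List ℕ → ℚ

ΦM : Mat → List ℕ → Elt
ΦM Φ α = map (λ β → (Φ α β , β)) (comps (size α))

tensor : Mat → Elt2 → Elt2
tensor Φ v = concatMap (λ t → concatMap (λ p → map (λ q →
               (proj₁ t ℚ.* proj₁ p ℚ.* proj₁ q , proj₂ p , proj₂ q))
               (ΦM Φ (proj₂ (proj₂ t)))) (ΦM Φ (proj₁ (proj₂ t)))) v

-- Φ is a graded Hopf algebra endomorphism of 𝒬 (graded bialgebra
-- endomorphism; over ℚ such a map automatically commutes with the
-- antipode, and the counit condition follows from gradedness + unit).
record IsGradedHopfEndo (Φ : Mat) : Set where
  field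
    unit   : Φ [] [] ≡ 1ℚ
    mult   : ∀ α β γ → IsComp α → IsComp β → IsComp γ →
             coeff γ (lin (ΦM Φ) (mul (M α) (M β))) ≡ coeff γ (mul (ΦM Φ α) (ΦM Φ β))
    comult : ∀ α β γ → IsComp α → IsComp β → IsComp γ →
             coeff2 β γ (Δ (ΦM Φ α)) ≡ coeff2 β γ (tensor Φ (Δ (M α)))

-- Evaluation of M_α at (x₁,…,x_m,0,0,…) :
--   M_α(x) = Σ_{i₁<…<i_k} x_{i₁}^{a₁} ⋯ x_{i_k}^{a_k}

powℚ : ℚ → ℕ → ℚ
powℚ x zero = 1ℚ
powℚ x (suc k) = x ℚ.* powℚ x k

evalM : List ℚ → List ℕ → ℚ
evalM xs [] = 1ℚ
evalM [] (b ∷ β) = 0ℚ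
evalM (x ∷ xs) (b ∷ β) = powℚ x b ℚ.* evalM xs β ℚ.+ evalM xs (b ∷ β)

F : List ℕ → Elt
F α = map (λ β → (1ℚ , β)) (filterᵇ (leq α) (comps (size α)))

evalF : List ℚ → List ℕ → ℚ
evalF xs α = sumℚ (map (λ p → proj₁ p ℚ.* evalM xs (proj₂ p)) (F α))

ζ : Elt → ℚ
ζ v = sumℚ (map (λ p → proj₁ p ℚ.* evalM (1ℚ ∷ []) (proj₂ p)) v)

ε₀ : List ℕ → ℚ
ε₀ α = if α == [] then 1ℚ else 0ℚ

-- a-th convolution power of ζ on basis elements:
--   ζ^{*0} = ε,  ζ^{*(a+1)} = (ζ ⊗ ζ^{*a}) ∘ Δ
ζpowM : ℕ → List ℕ → ℚ
ζpowM zero α = ε₀ α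
ζpowM (suc a) α = sumℚ (map (λ s → ζ (M (proj₁ s)) ℚ.* ζpowM a (proj₂ s)) (splits α))

ζpow : ℕ → Elt → ℚ
ζpow a v = sumℚ (map (λ p → proj₁ p ℚ.* ζpowM a (proj₂ p)) v)

IsΨ : ℕ → Mat → Set
IsΨ a Φ = (G : Elt) → All (λ p → IsComp (proj₂ p)) G → ζ (lin (ΦM Φ) G) ≡ ζpow a G

-- c is the matrix of Φ in the F-basis:  Φ(F_α) = Σ_β c α β F_β,
-- i.e. for every δ the M_δ-coefficients agree (M_δ occurs in F_β iff β ≤ δ).
IsFMatrix : Mat → Mat → Set
IsFMatrix Φ c = ∀ α δ → IsComp α → IsComp δ → size α ≡ size δ →
  coeff δ (lin (ΦM Φ) (F α)) ≡ sumℚ (map (c α) (filterᵇ (λ β → leq β δ) (comps (size δ))))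

-- Permutations of 𝔖_n in one-line notation σ = σ₀ σ₁ … σ_{n-1}, a word
-- containing each of 0,…,n-1 exactly once.

words : ℕ → ℕ → List (List ℕ)
words n zero = [] ∷ []
words n (suc k) = concatMap (λ x → map (x ∷_) (words n k)) (upTo n)

allPerms : ℕ → List (List ℕ)
allPerms n = filterᵇ (λ w → all (λ j → any (_≡ᵇ j) w) (upTo n)) (words n n)

-- descent positions (1-based) {i : σ_i > σ_{i+1}}, increasing
descsFrom : ℕ → List ℕ → List ℕ
descsFrom i [] = []
descsFrom i (x ∷ []) = []
descsFrom i (x ∷ y ∷ ys) =
  (if y <ᵇ x then i ∷ [] else []) ++ descsFrom (suc i) (y ∷ ys)

descs : List ℕ → List ℕ
descs = descsFrom 1

D : List ℕ → List ℕ
D σ = co (length σ) (descs σ)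

d : List ℕ → ℕ
d σ = length (descs σ)

indexOf : ℕ → List ℕ → ℕ
indexOf j [] = 0
indexOf j (x ∷ xs) = if x ≡ᵇ j then 0 else suc (indexOf j xs)

inv : List ℕ → List ℕ
inv σ = map (λ j → indexOf j σ) (upTo (length σ))

probA : (a : ℕ) → .{{NonZero a}} → List ℕ → ℚ
probA a σ = (+ ((n ℕ.+ a ∸ d (inv σ) ∸ 1) C n)) ℚ./ (a ℕ.^ n)
  where
  n = length σ
  instance _ = m^n≢0 a n

-- Fix a ≥ 1. Since (n) is the only composition β with β ≤ (n), the F-expansion of Φ(F_α)
-- shows that c_{α,(n)} is the coefficient of M_(n) in Φ(F_α); on a homogeneous element
-- this coefficient is the value at (1,0,0,…), so the defining property of Ψ_a turns it into
-- ζ^{*a}(F_α) = Σ_{β ≥ α} ζ^{*a}(M_β) = Σ_{β ≥ α} binom(a, ℓ(β)).  By Chu–Vandermonde this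
-- sum is binom(n + a - ℓ(α), n), i.e. binom(n + a - d(π) - 1, n) for α = D(π), which is the
-- numerator of Prob_a(π⁻¹) because d((π⁻¹)⁻¹) = d(π).  Worpitzky's identity
-- Σ_σ binom(n + a - d(σ) - 1, n) = aⁿ, proved by inserting the largest letter, gives the
-- normalisation.  Finally F_α(1/a,…,1/a,0,…) = Σ_{β ≥ α} M_β(1/a,…) = Σ_{β ≥ α} binom(a, ℓ(β)) / aⁿ
-- is the same sum divided by aⁿ.

module Submission where

module NatToRational where

  open import Data.Nat as ℕ using (ℕ; zero; suc; NonZero)
  open import Data.Nat.Properties using (m*n≢0; m^n≢0)
  open import Data.Nat.Solver using (module +-*-Solver)
  open import Data.Integer as ℤ using (+_)
  import Data.Integer.Properties as ℤ
  open import Data.Rational using (ℚ; 0ℚ; _/_; _+_; _*_; _≤_; toℚᵘ)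
  open import Data.Rational.Properties
  open import Data.Rational.Unnormalised as ℚᵘ using (mkℚᵘ; *≡*)
  import Data.Rational.Unnormalised.Properties as ℚᵘ
  open import Relation.Binary.PropositionalEquality
  open import Defs using (powℚ)

  toℚ : ℕ → ℚ
  toℚ m = + m / 1

  private
    toℚᵘ-/ : ∀ m M → toℚᵘ (+ m / suc M) ℚᵘ.≃ mkℚᵘ (+ m) M
    toℚᵘ-/ m M = toℚᵘ-fromℚᵘ (mkℚᵘ (+ m) M)

  /-cong-cross : ∀ m M k K .{{_ : NonZero M}} .{{_ : NonZero K}} →
                 m ℕ.* K ≡ k ℕ.* M → + m / M ≡ + k / K
  /-cong-cross m (suc M) k (suc K) e = fromℚᵘ-cong {mkℚᵘ (+ m) M} {mkℚᵘ (+ k) K}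
    (*≡* (trans (sym (ℤ.pos-* m (suc K))) (trans (cong +_ e) (ℤ.pos-* k (suc M)))))

  /-* : ∀ m M k K .{{_ : NonZero M}} .{{_ : NonZero K}} →
        (+ m / M) * (+ k / K) ≡ (+ (m ℕ.* k) / (M ℕ.* K)) {{m*n≢0 M K}}
  /-* m (suc M) k (suc K) = toℚᵘ-injective (ℚᵘ.≃-trans (toℚᵘ-homo-* (+ m / suc M) (+ k / suc K))
    (ℚᵘ.≃-trans (ℚᵘ.*-cong (toℚᵘ-/ m M) (toℚᵘ-/ k K))
    (ℚᵘ.≃-trans (*≡* (cong (ℤ._* + suc (K ℕ.+ M ℕ.* suc K)) (sym (ℤ.pos-* m k))))
    (ℚᵘ.≃-sym (toℚᵘ-/ (m ℕ.* k) (K ℕ.+ M ℕ.* suc K))))))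

  toℚ-+ : ∀ m k → toℚ (m ℕ.+ k) ≡ toℚ m + toℚ k
  toℚ-+ m k = toℚᵘ-injective (ℚᵘ.≃-trans (toℚᵘ-/ (m ℕ.+ k) 0)
    (ℚᵘ.≃-trans (*≡* e)
    (ℚᵘ.≃-sym (ℚᵘ.≃-trans (toℚᵘ-homo-+ (toℚ m) (toℚ k)) (ℚᵘ.+-cong (toℚᵘ-/ m 0) (toℚᵘ-/ k 0))))))
    where
    e : + (m ℕ.+ k) ℤ.* + 1 ≡ (+ m ℤ.* + 1 ℤ.+ + k ℤ.* + 1) ℤ.* + 1
    e rewrite ℤ.*-identityʳ (+ m) | ℤ.*-identityʳ (+ k) | ℤ.*-identityʳ (+ m ℤ.+ + k) = ℤ.pos-+ m k

  toℚ-injective : ∀ {m k} → toℚ m ≡ toℚ k → m ≡ k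
  toℚ-injective {m} {k} e with ℚᵘ.≃-trans (ℚᵘ.≃-sym (toℚᵘ-/ m 0)) (ℚᵘ.≃-trans (toℚᵘ-cong e) (toℚᵘ-/ k 0))
  ... | *≡* e′ = ℤ.+-injective (trans (sym (ℤ.*-identityʳ (+ m))) (trans e′ (ℤ.*-identityʳ (+ k))))

  toℚ-nonNeg : ∀ m → 0ℚ ≤ toℚ m
  toℚ-nonNeg m = nonNegative⁻¹ (toℚ m) {{normalize-nonNeg m 1}}

  /-*-cancel : ∀ m N .{{_ : NonZero N}} → (+ m / N) * toℚ N ≡ toℚ m
  /-*-cancel m N = trans (/-* m N N 1) (/-cong-cross (m ℕ.* N) (N ℕ.* 1) m 1 {{m*n≢0 N 1}} e)
    where
    open +-*-Solver
    e : m ℕ.* N ℕ.* 1 ≡ m ℕ.* (N ℕ.* 1)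
    e = solve 2 (λ m N → m :* N :* con 1 := m :* (N :* con 1)) refl m N

  powℚ-1/ : ∀ a .{{_ : NonZero a}} n → powℚ (+ 1 / a) n ≡ (+ 1 / a ℕ.^ n) {{m^n≢0 a n}}
  powℚ-1/ a zero = refl
  powℚ-1/ a {{a≢0}} (suc n) = trans (cong ((+ 1 / a) *_) (powℚ-1/ a n)) (/-* 1 a 1 (a ℕ.^ n) {{a≢0}} {{m^n≢0 a n}})

  powℚ-1/-*-toℚ : ∀ a .{{_ : NonZero a}} n m → powℚ (+ 1 / a) n * toℚ m ≡ (+ m / a ℕ.^ n) {{m^n≢0 a n}}
  powℚ-1/-*-toℚ a n m = trans (cong (_* toℚ m) (powℚ-1/ a n))
    (trans (/-* 1 (a ℕ.^ n) m 1 {{m^n≢0 a n}})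
    (/-cong-cross (1 ℕ.* m) (a ℕ.^ n ℕ.* 1) m (a ℕ.^ n) {{m*n≢0 (a ℕ.^ n) 1 {{m^n≢0 a n}}}} {{m^n≢0 a n}} e))
    where
    open +-*-Solver
    e : 1 ℕ.* m ℕ.* a ℕ.^ n ≡ m ℕ.* (a ℕ.^ n ℕ.* 1)
    e = solve 2 (λ m p → con 1 :* m :* p := m :* (p :* con 1)) refl m (a ℕ.^ n)

module NatTests where

  open import Data.Nat
  open import Data.Nat.Properties using (≡ᵇ⇒≡; ≡⇒≡ᵇ; <ᵇ⇒<; <⇒<ᵇ; <-asym)
  open import Data.Bool using (true; false; T)
  open import Data.Bool.Properties using (T-≡; ¬-not)
  open import Function using (Equivalence)
  open import Relation.Binary.PropositionalEquality

  ≡ᵇ-refl : ∀ n → (n ≡ᵇ n) ≡ true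
  ≡ᵇ-refl n = Equivalence.to T-≡ (≡⇒≡ᵇ n n refl)

  ≢⇒≡ᵇ-false : ∀ {m n} → m ≢ n → (m ≡ᵇ n) ≡ false
  ≢⇒≡ᵇ-false {m} {n} m≢n = ¬-not (λ e → m≢n (≡ᵇ⇒≡ m n (Equivalence.from T-≡ e)))

  ≡ᵇ-true⇒≡ : ∀ {m n} → (m ≡ᵇ n) ≡ true → m ≡ n
  ≡ᵇ-true⇒≡ {m} {n} e = ≡ᵇ⇒≡ m n (Equivalence.from T-≡ e)

  ≡ᵇ-false⇒≢ : ∀ {m n} → (m ≡ᵇ n) ≡ false → m ≢ n
  ≡ᵇ-false⇒≢ {m} e refl = subst T e (≡⇒≡ᵇ m m refl)

  <⇒<ᵇ-true : ∀ {m n} → m < n → (m <ᵇ n) ≡ true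
  <⇒<ᵇ-true m<n = Equivalence.to T-≡ (<⇒<ᵇ m<n)

  <⇒>ᵇ-false : ∀ {m n} → m < n → (n <ᵇ m) ≡ false
  <⇒>ᵇ-false {m} {n} m<n = ¬-not (λ e → <-asym m<n (<ᵇ⇒< n m (Equivalence.from T-≡ e)))

module NatSums where

  open import Data.Nat
  open import Data.Nat.Properties using (*-zeroʳ; *-distribˡ-+)
  open import Data.Nat.ListAction using (sum)
  open import Data.Nat.ListAction.Properties using (sum-++)
  open import Data.Bool using (Bool; true; false; if_then_else_)
  open import Data.List using ([]; _∷_; map; _++_; filterᵇ; cartesianProduct)
  open import Data.List.Properties using (map-++; map-∘)
  open import Data.List.Relation.Unary.All using (All; []; _∷_)
  open import Data.Product using (_,_; uncurry)
  open import Relation.Binary.PropositionalEquality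

  private variable
    A B : Set

  sum-map-++ : ∀ (h : A → ℕ) xs ys → sum (map h (xs ++ ys)) ≡ sum (map h xs) + sum (map h ys)
  sum-map-++ h xs ys = trans (cong sum (map-++ h xs ys)) (sum-++ (map h xs) (map h ys))

  sum-map-zero : ∀ (h : A → ℕ) xs → All (λ x → h x ≡ 0) xs → sum (map h xs) ≡ 0
  sum-map-zero h [] [] = refl
  sum-map-zero h (x ∷ xs) (hx≡0 ∷ rest) rewrite hx≡0 = sum-map-zero h xs rest

  sum-map-* : ∀ c (g : A → ℕ) xs → sum (map (λ x → c * g x) xs) ≡ c * sum (map g xs)
  sum-map-* c g [] = sym (*-zeroʳ c)
  sum-map-* c g (x ∷ xs) = trans (cong (c * g x +_) (sum-map-* c g xs)) (sym (*-distribˡ-+ c (g x) _))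

  sum-filterᵇ : ∀ (p : A → Bool) (g : A → ℕ) xs →
    sum (map g (filterᵇ p xs)) ≡ sum (map (λ x → if p x then g x else 0) xs)
  sum-filterᵇ p g [] = refl
  sum-filterᵇ p g (x ∷ xs) with p x
  ... | true = cong (g x +_) (sum-filterᵇ p g xs)
  ... | false = sum-filterᵇ p g xs

  sum-cartesianProduct : ∀ (g : A → B → ℕ) xs ys →
    sum (map (uncurry g) (cartesianProduct xs ys)) ≡ sum (map (λ x → sum (map (g x) ys)) xs)
  sum-cartesianProduct g [] ys = refl
  sum-cartesianProduct g (x ∷ xs) ys =
    trans (sum-map-++ (uncurry g) (map (x ,_) ys) _)
          (cong₂ _+_ (cong sum (sym (map-∘ ys))) (sum-cartesianProduct g xs ys))

module Binomial where

  open import Data.Nat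
  open import Data.Nat.Properties
  open import Data.Nat.Combinatorics using (_C_; nCk+nC[k+1]≡[n+1]C[k+1]; k>n⇒nCk≡0)
  open import Data.Nat.Solver using (module +-*-Solver)
  open import Relation.Binary.PropositionalEquality
  open import Relation.Nullary using (yes; no)
  open +-*-Solver
  open ≡-Reasoning

  -- Used instead of _C_ so that Pascal's rule holds definitionally.
  binom : ℕ → ℕ → ℕ
  binom n zero = 1
  binom zero (suc k) = 0
  binom (suc n) (suc k) = binom n k + binom n (suc k)

  binom≡C : ∀ n k → binom n k ≡ n C k
  binom≡C zero zero = refl
  binom≡C (suc n) zero = refl
  binom≡C zero (suc k) = sym (k>n⇒nCk≡0 {0} {suc k} z<s)
  binom≡C (suc n) (suc k) =
    trans (cong₂ _+_ (binom≡C n k) (binom≡C n (suc k))) (nCk+nC[k+1]≡[n+1]C[k+1] n k)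

  binom-< : ∀ {n k} → n < k → binom n k ≡ 0
  binom-< {n} {k} n<k = trans (binom≡C n k) (k>n⇒nCk≡0 n<k)

  binom-absorption : ∀ n k → suc k * binom n (suc k) ≡ (n ∸ k) * binom n k
  binom-absorption zero k = trans (*-zeroʳ (suc k)) (cong (_* binom 0 k) (sym (0∸n≡0 k)))
  binom-absorption (suc n) zero = cong suc (trans (+-identityʳ (binom n 1)) (trans (binom-1 n) (sym (*-identityʳ n))))
    where
    binom-1 : ∀ n → binom n 1 ≡ n
    binom-1 zero = refl
    binom-1 (suc n) = cong suc (binom-1 n)
  binom-absorption (suc n) (suc k) with k <? n
  ... | yes k<n =
    begin
      (2 + k) * (binom n (suc k) + binom n (2 + k))
    ≡⟨ *-distribˡ-+ (2 + k) (binom n (suc k)) _ ⟩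
      (2 + k) * binom n (suc k) + (2 + k) * binom n (2 + k)
    ≡⟨ cong ((2 + k) * binom n (suc k) +_) (binom-absorption n (suc k)) ⟩
      (2 + k) * binom n (suc k) + (n ∸ suc k) * binom n (suc k)
    ≡⟨ sym (*-distribʳ-+ (binom n (suc k)) (2 + k) (n ∸ suc k)) ⟩
      (2 + k + (n ∸ suc k)) * binom n (suc k)
    ≡⟨ cong (_* binom n (suc k)) (trans (cong suc (m+[n∸m]≡n k<n)) (sym (cong suc (m+[n∸m]≡n (<⇒≤ k<n))))) ⟩
      (suc k + (n ∸ k)) * binom n (suc k)
    ≡⟨ *-distribʳ-+ (binom n (suc k)) (suc k) (n ∸ k) ⟩
      suc k * binom n (suc k) + (n ∸ k) * binom n (suc k)
    ≡⟨ cong (_+ (n ∸ k) * binom n (suc k)) (binom-absorption n k) ⟩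
      (n ∸ k) * binom n k + (n ∸ k) * binom n (suc k)
    ≡⟨ sym (*-distribˡ-+ (n ∸ k) (binom n k) _) ⟩
      (n ∸ k) * (binom n k + binom n (suc k))
    ∎
  ... | no k≮n = begin
      (2 + k) * (binom n (suc k) + binom n (2 + k))
    ≡⟨ cong ((2 + k) *_) (cong₂ _+_ (binom-< (s≤s n≤k)) (binom-< (s≤s (m≤n⇒m≤1+n n≤k)))) ⟩
      (2 + k) * 0
    ≡⟨ *-zeroʳ (2 + k) ⟩
      0
    ≡⟨ cong (_* (binom n k + binom n (suc k))) (sym (m≤n⇒m∸n≡0 n≤k)) ⟩
      (n ∸ k) * (binom n k + binom n (suc k))
    ∎
    where n≤k = ≮⇒≥ k≮n

  -- The number of a-shuffles of n cards that produce a given permutation whose inverse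
  -- has d descents.
  riffles : ℕ → ℕ → ℕ → ℕ
  riffles a n d = binom (n + a ∸ d ∸ 1) n

  private
    insertion-step : ∀ a d e → suc d * binom (suc (e + a)) (suc (d + e)) + e * binom (e + a) (suc (d + e))
                                ≡ suc a * binom (e + a) (d + e)
    insertion-step a d e =
      begin
        suc d * (B₀ + B₁) + e * B₁
      ≡⟨ solve 4 (λ d e b₀ b₁ → (con 1 :+ d) :* (b₀ :+ b₁) :+ e :* b₁
                                 := (con 1 :+ d) :* b₀ :+ (con 1 :+ (d :+ e)) :* b₁) refl d e B₀ B₁ ⟩
        suc d * B₀ + suc (d + e) * B₁
      ≡⟨ cong (suc d * B₀ +_) (binom-absorption (e + a) (d + e)) ⟩
        suc d * B₀ + (e + a ∸ (d + e)) * B₀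
      ≡⟨ sym (*-distribʳ-+ B₀ (suc d) _) ⟩
        (suc d + (e + a ∸ (d + e))) * B₀
      ≡⟨ factor ⟩
        suc a * B₀
      ∎
      where
      B₀ = binom (e + a) (d + e)
      B₁ = binom (e + a) (suc (d + e))
      factor : (suc d + (e + a ∸ (d + e))) * B₀ ≡ suc a * B₀
      factor with d ≤? a
      ... | yes d≤a = cong (λ x → suc x * B₀) (trans (cong (d +_) e+a∸[d+e]≡a∸d) (m+[n∸m]≡n d≤a))
        where
        e+a∸[d+e]≡a∸d : e + a ∸ (d + e) ≡ a ∸ d
        e+a∸[d+e]≡a∸d = trans (cong₂ _∸_ (+-comm e a) (+-comm d e))
                          (trans (sym (∸-+-assoc (a + e) e d)) (cong (_∸ d) (m+n∸n≡m a e)))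
      ... | no d≰a rewrite binom-< {e + a} {d + e} (subst (_< d + e) (+-comm a e) (+-monoˡ-< e (≰⇒> d≰a)))
                   = trans (*-zeroʳ (suc d + (e + a ∸ (d + e)))) (sym (*-zeroʳ (suc a)))

  riffles-insertion : ∀ a n d → d ≤ n →
    suc d * riffles (suc a) (suc n) d + (n ∸ d) * riffles (suc a) (suc n) (suc d) ≡ suc a * riffles (suc a) n d
  riffles-insertion a n d d≤n = subst
    (λ m → suc d * riffles (suc a) (suc m) d + (m ∸ d) * riffles (suc a) (suc m) (suc d) ≡ suc a * riffles (suc a) m d)
    (m+[n∸m]≡n d≤n) (with-n≡d+ (n ∸ d))
    where
    with-n≡d+ : ∀ e → suc d * riffles (suc a) (suc (d + e)) d + (d + e ∸ d) * riffles (suc a) (suc (d + e)) (suc d)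
                      ≡ suc a * riffles (suc a) (d + e) d
    with-n≡d+ e rewrite m+n∸m≡n d e =
      trans (cong₂ (λ x y → suc d * binom x (suc (d + e)) + e * binom y (suc (d + e))) top₁ top₂)
            (trans (insertion-step a d e) (cong (λ x → suc a * binom x (d + e)) (sym top₃)))
      where
      top₁ : suc (d + e) + suc a ∸ d ∸ 1 ≡ suc (e + a)
      top₁ = trans (cong (λ x → x ∸ d ∸ 1) (solve 3 (λ d e a → con 1 :+ (d :+ e) :+ (con 1 :+ a) := d :+ (con 2 :+ (e :+ a))) refl d e a))
                   (cong (_∸ 1) (m+n∸m≡n d (2 + (e + a))))
      top₂ : suc (d + e) + suc a ∸ suc d ∸ 1 ≡ e + a
      top₂ = trans (cong (λ x → x ∸ suc d ∸ 1)
                     (solve 3 (λ d e a → con 1 :+ (d :+ e) :+ (con 1 :+ a) := (con 1 :+ d) :+ (con 1 :+ (e :+ a))) refl d e a))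
                   (cong (_∸ 1) (m+n∸m≡n (suc d) (suc (e + a))))
      top₃ : d + e + suc a ∸ d ∸ 1 ≡ e + a
      top₃ = trans (cong (λ x → x ∸ d ∸ 1) (solve 3 (λ d e a → d :+ e :+ (con 1 :+ a) := d :+ (con 1 :+ (e :+ a))) refl d e a))
                   (cong (_∸ 1) (m+n∸m≡n d (suc (e + a))))

module Descents where

  open import Data.Nat
  open import Data.Nat.Properties
  open import Data.Nat.ListAction using (sum)
  open import Data.Nat.Solver using (module +-*-Solver)
  open import Data.Bool using (Bool; true; false; if_then_else_)
  open import Data.List using (List; []; _∷_; length; _++_; applyUpTo)
  open import Data.List.Relation.Unary.All using (All; []; _∷_)
  open import Relation.Binary.PropositionalEquality
  open import Defs using (descsFrom)
  open NatTests using (<⇒<ᵇ-true; <⇒>ᵇ-false)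
  open +-*-Solver
  open ≡-Reasoning

  iverson : Bool → ℕ
  iverson b = if b then 1 else 0

  des : List ℕ → ℕ
  des [] = 0
  des (x ∷ []) = 0
  des (x ∷ y ∷ ys) = iverson (y <ᵇ x) + des (y ∷ ys)

  length-descsFrom : ∀ i w → length (descsFrom i w) ≡ des w
  length-descsFrom i [] = refl
  length-descsFrom i (x ∷ []) = refl
  length-descsFrom i (x ∷ y ∷ ys) = trans (length-if (y <ᵇ x)) (cong (iverson (y <ᵇ x) +_) (length-descsFrom (suc i) (y ∷ ys)))
    where
    length-if : ∀ b → length ((if b then i ∷ [] else []) ++ descsFrom (suc i) (y ∷ ys))
                      ≡ iverson b + length (descsFrom (suc i) (y ∷ ys))
    length-if true = refl
    length-if false = refl

  des-∷-≤ : ∀ x τ → des (x ∷ τ) ≤ length τ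
  des-∷-≤ x [] = z≤n
  des-∷-≤ x (y ∷ τ) with y <ᵇ x
  ... | true = s≤s (des-∷-≤ y τ)
  ... | false = m≤n⇒m≤1+n (des-∷-≤ y τ)

  des-≤ : ∀ τ → des τ ≤ length τ
  des-≤ [] = z≤n
  des-≤ (x ∷ τ) = m≤n⇒m≤1+n (des-∷-≤ x τ)

  insertAt : ℕ → ℕ → List ℕ → List ℕ
  insertAt zero m τ = m ∷ τ
  insertAt (suc i) m [] = m ∷ []
  insertAt (suc i) m (x ∷ τ) = x ∷ insertAt i m τ

  private
    sumInsertionsAfterHead : (ℕ → ℕ) → ℕ → ℕ → List ℕ → ℕ
    sumInsertionsAfterHead f m x τ = sum (applyUpTo (λ j → f (des (insertAt (suc j) m (x ∷ τ)))) (suc (length τ)))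

    regroup : ∀ (f : ℕ → ℕ) b d L → d ≤ L →
      f (suc d) + (suc d * f (iverson b + d) + (L ∸ d) * f (iverson b + suc d))
      ≡ suc (iverson b + d) * f (iverson b + d) + (suc L ∸ (iverson b + d)) * f (suc (iverson b + d))
    regroup f true d L d≤L =
      solve 3 (λ u v w → u :+ (v :* u :+ w) := (con 1 :+ v) :* u :+ w) refl (f (suc d)) (suc d) ((L ∸ d) * f (2 + d))
    regroup f false d L d≤L rewrite +-∸-assoc 1 d≤L =
      solve 4 (λ u v w z → u :+ (v :* w :+ z :* u) := v :* w :+ (con 1 :+ z) :* u) refl (f (suc d)) (suc d) (f d) (L ∸ d)

    sumInsertionsAfterHead-max : ∀ (f : ℕ → ℕ) m x τ → All (_< m) (x ∷ τ) →
      sumInsertionsAfterHead f m x τ ≡ suc (des (x ∷ τ)) * f (des (x ∷ τ)) + (length τ ∸ des (x ∷ τ)) * f (suc (des (x ∷ τ)))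
    sumInsertionsAfterHead-max f m x [] (x<m ∷ []) rewrite <⇒>ᵇ-false x<m = sym (+-identityʳ (f 0 + 0))
    sumInsertionsAfterHead-max f m x (y ∷ τ) (x<m ∷ y<m ∷ τ<m) =
      begin
        f (des (x ∷ m ∷ y ∷ τ)) + sumInsertionsAfterHead (λ k → f (δ + k)) m y τ
      ≡⟨ cong (_+ sumInsertionsAfterHead (λ k → f (δ + k)) m y τ) (cong f m-is-descent) ⟩
        f (suc d) + sumInsertionsAfterHead (λ k → f (δ + k)) m y τ
      ≡⟨ cong (f (suc d) +_) (sumInsertionsAfterHead-max (λ k → f (δ + k)) m y τ (y<m ∷ τ<m)) ⟩
        f (suc d) + (suc d * f (δ + d) + (length τ ∸ d) * f (δ + suc d))
      ≡⟨ regroup f (y <ᵇ x) d (length τ) (des-∷-≤ y τ) ⟩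
        suc (δ + d) * f (δ + d) + (suc (length τ) ∸ (δ + d)) * f (suc (δ + d))
      ∎
      where
      d = des (y ∷ τ)
      δ = iverson (y <ᵇ x)
      m-is-descent : des (x ∷ m ∷ y ∷ τ) ≡ suc d
      m-is-descent rewrite <⇒>ᵇ-false x<m | <⇒<ᵇ-true y<m = refl

  -- Inserting a new largest letter into a descent slot or at the end keeps the number of
  -- descents, and into any of the other slots raises it by one.
  sum-des-insertAt-max : ∀ (f : ℕ → ℕ) m τ → All (_< m) τ →
    sum (applyUpTo (λ i → f (des (insertAt i m τ))) (suc (length τ)))
    ≡ suc (des τ) * f (des τ) + (length τ ∸ des τ) * f (suc (des τ))
  sum-des-insertAt-max f m [] [] = sym (+-identityʳ (f 0 + 0))
  sum-des-insertAt-max f m (x ∷ τ) (x<m ∷ τ<m) =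
    begin
      f (des (m ∷ x ∷ τ)) + sumInsertionsAfterHead f m x τ
    ≡⟨ cong₂ _+_ (cong f m-is-descent) (sumInsertionsAfterHead-max f m x τ (x<m ∷ τ<m)) ⟩
      f (suc d) + (suc d * f d + (length τ ∸ d) * f (suc d))
    ≡⟨ regroup f false d (length τ) (des-∷-≤ x τ) ⟩
      suc d * f d + (suc (length τ) ∸ d) * f (suc d)
    ∎
    where
    d = des (x ∷ τ)
    m-is-descent : des (m ∷ x ∷ τ) ≡ suc d
    m-is-descent rewrite <⇒<ᵇ-true x<m = refl

module UniqueLists where

  open import Data.Nat
  open import Data.Nat.Properties
  open import Data.Nat.ListAction using (sum)
  open import Data.Nat.ListAction.Properties using (sum-↭)
  open import Data.List using (List; []; _∷_; map; length; _++_)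
  open import Data.List.Properties using (map-∘; length-++-sucʳ)
  open import Data.List.Relation.Unary.All as All using (All; []; _∷_)
  open import Data.List.Relation.Unary.All.Properties using (All¬⇒¬Any)
  open import Data.List.Relation.Unary.Any using (here; there)
  open import Data.List.Relation.Unary.Unique.Propositional using (Unique)
  open import Data.List.Relation.Unary.AllPairs using ([]; _∷_)
  open import Data.List.Relation.Binary.Subset.Propositional using (_⊆_)
  open import Data.List.Relation.Binary.BagAndSetEquality using (∼bag⇒↭)
  import Data.List.Relation.Binary.Permutation.Propositional.Properties as ↭
  open import Data.List.Membership.Propositional using (_∈_; _∉_)
  open import Data.List.Membership.Propositional.Properties using (∈-map⁺; ∈-map⁻; ∈-∃++; ∈-++⁻; ∈-++⁺ˡ; ∈-++⁺ʳ)
  open import Data.List.Membership.Propositional.Properties.WithK using (unique∧set⇒bag)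
  open import Data.List.Membership.DecPropositional _≟_ using (_∈?_)
  open import Data.Product using (_×_; _,_)
  open import Data.Sum using (inj₁; inj₂)
  open import Data.Empty using (⊥; ⊥-elim)
  open import Function using (_∘_; mk⇔)
  open import Relation.Binary.PropositionalEquality
  open import Relation.Nullary using (yes; no)

  private variable
    A B : Set

  ∈-++-∷⁻ : ∀ (xs ys : List A) {x y} → y ∈ xs ++ x ∷ ys → y ≢ x → y ∈ xs ++ ys
  ∈-++-∷⁻ xs ys y∈ y≢x with ∈-++⁻ xs y∈
  ... | inj₁ y∈xs = ∈-++⁺ˡ y∈xs
  ... | inj₂ (here y≡x) = ⊥-elim (y≢x y≡x)
  ... | inj₂ (there y∈ys) = ∈-++⁺ʳ xs y∈ys

  ∈-++-∷⁺ : ∀ (xs ys : List A) {x y} → y ∈ xs ++ ys → y ∈ xs ++ x ∷ ys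
  ∈-++-∷⁺ xs ys y∈ with ∈-++⁻ xs y∈
  ... | inj₁ y∈xs = ∈-++⁺ˡ y∈xs
  ... | inj₂ y∈ys = ∈-++⁺ʳ xs (there y∈ys)

  Unique-++-∷⁻ : ∀ (xs ys : List A) {x} → Unique (xs ++ x ∷ ys) → Unique (xs ++ ys) × x ∉ xs ++ ys
  Unique-++-∷⁻ [] ys (x∉ys ∷ ys!) = ys! , All¬⇒¬Any x∉ys
  Unique-++-∷⁻ (z ∷ xs) ys {x} (z∉ ∷ rest!) with Unique-++-∷⁻ xs ys rest!
  ... | rest′! , x∉ = All.tabulate (λ y∈ → All.lookup z∉ (∈-++-∷⁺ xs ys y∈)) ∷ rest′! , x∉z∷
    where
    x∉z∷ : x ∉ z ∷ xs ++ ys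
    x∉z∷ (here refl) = All.lookup z∉ (∈-++⁺ʳ xs (here refl)) refl
    x∉z∷ (there x∈) = x∉ x∈

  Unique-⊆⇒length-≤ : ∀ {xs ys : List A} → Unique xs → xs ⊆ ys → length xs ≤ length ys
  Unique-⊆⇒length-≤ {xs = []} _ _ = z≤n
  Unique-⊆⇒length-≤ {xs = x ∷ xs} (x∉xs ∷ xs!) x∷xs⊆ys with ∈-∃++ (x∷xs⊆ys (here refl))
  ... | us , vs , refl = subst (suc (length xs) ≤_) (sym (length-++-sucʳ us x vs))
    (s≤s (Unique-⊆⇒length-≤ xs! (λ y∈xs → ∈-++-∷⁻ us vs (x∷xs⊆ys (there y∈xs))
                                                   (λ y≡x → All.lookup x∉xs y∈xs (sym y≡x)))))

  ⊆-length-≤⇒Unique : ∀ (xs ys : List ℕ) → Unique xs → xs ⊆ ys → length ys ≤ length xs → Unique ys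
  ⊆-length-≤⇒Unique xs [] _ _ _ = []
  ⊆-length-≤⇒Unique xs (y ∷ ys) xs! xs⊆ ys≤ = All.tabulate y∉ys ∷ ys!
    where
    too-long : xs ⊆ ys → ⊥
    too-long xs⊆ys = <⇒≱ ys≤ (Unique-⊆⇒length-≤ xs! xs⊆ys)
    y∉ys : ∀ {z} → z ∈ ys → y ≢ z
    y∉ys z∈ys refl = too-long (λ x∈xs → case-head (xs⊆ x∈xs))
      where
      case-head : ∀ {x} → x ∈ y ∷ ys → x ∈ ys
      case-head (here refl) = z∈ys
      case-head (there x∈ys) = x∈ys
    ys! : Unique ys
    ys! with y ∈? xs
    ... | no y∉xs = ⊥-elim (too-long (λ {x} x∈xs → drop-head x∈xs (xs⊆ x∈xs)))
      where
      drop-head : ∀ {x} → x ∈ xs → x ∈ y ∷ ys → x ∈ ys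
      drop-head x∈xs (here refl) = ⊥-elim (y∉xs x∈xs)
      drop-head x∈xs (there x∈ys) = x∈ys
    ... | yes y∈xs with ∈-∃++ y∈xs
    ... | us , vs , refl with Unique-++-∷⁻ us vs xs!
    ... | us++vs! , y∉ = ⊆-length-≤⇒Unique (us ++ vs) ys us++vs! us++vs⊆ys
          (≤-pred (subst (suc (length ys) ≤_) (length-++-sucʳ us y vs) ys≤))
      where
      us++vs⊆ys : us ++ vs ⊆ ys
      us++vs⊆ys x∈ with xs⊆ (∈-++-∷⁺ us vs x∈)
      ... | here refl = ⊥-elim (y∉ x∈)
      ... | there x∈ys = x∈ys

  map-Unique : ∀ (f : B → A) (g : A → B) {xs} → All (λ x → g (f x) ≡ x) xs → Unique xs → Unique (map f xs)
  map-Unique f g {[]} _ _ = []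
  map-Unique f g {x ∷ xs} (gfx≡x ∷ inv) (x∉xs ∷ xs!) = All.tabulate fx≢ ∷ map-Unique f g inv xs!
    where
    fx≢ : ∀ {y} → y ∈ map f xs → f x ≢ y
    fx≢ y∈ fx≡y with ∈-map⁻ f y∈
    ... | z , z∈xs , refl = All.lookup x∉xs z∈xs (trans (sym gfx≡x) (trans (cong g fx≡y) (All.lookup inv z∈xs)))

  sum-reindex : ∀ (h : A → ℕ) {xs : List A} {ys : List B} (f : B → A) (g : A → B) →
    Unique xs → Unique ys →
    (∀ {y} → y ∈ ys → f y ∈ xs) → (∀ {x} → x ∈ xs → g x ∈ ys) →
    All (λ y → g (f y) ≡ y) ys → (∀ {x} → x ∈ xs → f (g x) ≡ x) →
    sum (map h xs) ≡ sum (map (h ∘ f) ys)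
  sum-reindex h {xs} {ys} f g xs! ys! f∈ g∈ gf fg =
    trans (sum-↭ (↭.map⁺ h (∼bag⇒↭ (unique∧set⇒bag xs! (map-Unique f g gf ys!) (mk⇔ to from)))))
          (cong sum (sym (map-∘ ys)))
    where
    to : ∀ {x} → x ∈ xs → x ∈ map f ys
    to x∈ = subst (_∈ map f ys) (fg x∈) (∈-map⁺ f (g∈ x∈))
    from : ∀ {x} → x ∈ map f ys → x ∈ xs
    from x∈ with ∈-map⁻ f x∈
    ... | y , y∈ , refl = f∈ y∈

module Permutations where

  open import Data.Nat
  open import Data.Nat.Properties
  open import Data.Bool using (Bool; T)
  open import Data.Bool.ListAction using (all; any)
  open import Data.List using (List; []; _∷_; _++_; map; upTo; length; concatMap; cartesianProductWith)
  open import Data.List.Properties using (length-upTo)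
  open import Data.List.Relation.Unary.All as All using (All; []; _∷_)
  open import Data.List.Relation.Unary.All.Properties using (all⁺; all⁻)
  open import Data.List.Relation.Unary.Any as Any using (here)
  open import Data.List.Relation.Unary.Any.Properties using (any⁺; any⁻)
  open import Data.List.Relation.Unary.Unique.Propositional using (Unique)
  import Data.List.Relation.Unary.Unique.Propositional.Properties as Unique
  open import Data.List.Relation.Unary.AllPairs using ([]; _∷_)
  open import Data.List.Membership.Propositional using (_∈_; lose; find)
  open import Data.List.Membership.Propositional.Properties
    using (∈-filter⁺; ∈-filter⁻; ∈-map⁺; ∈-map⁻; ∈-concatMap⁺; ∈-concatMap⁻; ∈-upTo⁺; ∈-upTo⁻)
  open import Data.Product using (_×_; _,_)
  open import Function using (_∘_)
  open import Relation.Binary.PropositionalEquality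
  open import Relation.Nullary.Decidable using (T?)
  open import Defs using (words; allPerms)
  open UniqueLists using (⊆-length-≤⇒Unique)

  IsPerm : ℕ → List ℕ → Set
  IsPerm n σ = length σ ≡ n × All (_< n) σ × (∀ j → j < n → j ∈ σ)

  ∈-words⁺ : ∀ n w → All (_< n) w → w ∈ words n (length w)
  ∈-words⁺ n [] [] = here refl
  ∈-words⁺ n (x ∷ w) (x<n ∷ w<n) =
    ∈-concatMap⁺ (λ y → map (y ∷_) (words n (length w))) (lose (∈-upTo⁺ x<n) (∈-map⁺ (x ∷_) (∈-words⁺ n w w<n)))

  ∈-words⁻ : ∀ n k w → w ∈ words n k → length w ≡ k × All (_< n) w
  ∈-words⁻ n zero .[] (here refl) = refl , []
  ∈-words⁻ n (suc k) w w∈ with find (∈-concatMap⁻ (λ y → map (y ∷_) (words n k)) {xs = upTo n} w∈)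
  ... | x , x∈ , w∈′ with ∈-map⁻ (x ∷_) w∈′
  ... | w′ , w′∈ , refl with ∈-words⁻ n k w′ w′∈
  ... | |w′|≡k , w′<n = cong suc |w′|≡k , ∈-upTo⁻ x∈ ∷ w′<n

  words-unique : ∀ n k → Unique (words n k)
  words-unique n zero = [] ∷ []
  words-unique n (suc k) = subst Unique (sym (concatMap≡cartesianProductWith (upTo n)))
    (Unique.cartesianProductWith⁺ _∷_ ∷-injective (Unique.upTo⁺ n) (words-unique n k))
    where
    concatMap≡cartesianProductWith : ∀ xs → concatMap (λ x → map (x ∷_) (words n k)) xs
                                            ≡ cartesianProductWith _∷_ xs (words n k)
    concatMap≡cartesianProductWith [] = refl
    concatMap≡cartesianProductWith (x ∷ xs) = cong (map (x ∷_) (words n k) ++_) (concatMap≡cartesianProductWith xs)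
    ∷-injective : ∀ {x y : ℕ} {xs ys} → x ∷ xs ≡ y ∷ ys → x ≡ y × xs ≡ ys
    ∷-injective refl = refl , refl

  private
    contains : ℕ → List ℕ → Bool
    contains n w = all (λ j → any (_≡ᵇ j) w) (upTo n)

    any-≡ᵇ⁺ : ∀ {j σ} → j ∈ σ → T (any (_≡ᵇ j) σ)
    any-≡ᵇ⁺ {j} j∈σ = any⁺ (_≡ᵇ j) (Any.map (λ { refl → ≡⇒≡ᵇ j j refl }) j∈σ)

    any-≡ᵇ⁻ : ∀ {j} σ → T (any (_≡ᵇ j) σ) → j ∈ σ
    any-≡ᵇ⁻ {j} σ t = Any.map (λ {x} x≡ᵇj → sym (≡ᵇ⇒≡ x j x≡ᵇj)) (any⁻ (_≡ᵇ j) σ t)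

  ∈-allPerms⁻ : ∀ {n σ} → σ ∈ allPerms n → IsPerm n σ
  ∈-allPerms⁻ {n} {σ} σ∈ with ∈-filter⁻ (T? ∘ contains n) {xs = words n n} σ∈
  ... | σ∈words , covers with ∈-words⁻ n n σ σ∈words
  ... | |σ|≡n , σ<n = |σ|≡n , σ<n , λ j j<n → any-≡ᵇ⁻ σ (All.lookup (all⁺ _ (upTo n) covers) (∈-upTo⁺ j<n))

  ∈-allPerms⁺ : ∀ {n σ} → IsPerm n σ → σ ∈ allPerms n
  ∈-allPerms⁺ {n} {σ} (refl , σ<n , covers) = ∈-filter⁺ (T? ∘ contains n) (∈-words⁺ n σ σ<n)
    (all⁻ _ (All.tabulate (λ j∈ → any-≡ᵇ⁺ (covers _ (∈-upTo⁻ j∈)))))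

  allPerms-unique : ∀ n → Unique (allPerms n)
  allPerms-unique n = Unique.filter⁺ (T? ∘ contains n) (words-unique n n)

  IsPerm⇒Unique : ∀ {n σ} → IsPerm n σ → Unique σ
  IsPerm⇒Unique {n} {σ} (|σ|≡n , _ , covers) = ⊆-length-≤⇒Unique (upTo n) σ (Unique.upTo⁺ n)
    (λ j∈ → covers _ (∈-upTo⁻ j∈)) (≤-reflexive (trans |σ|≡n (sym (length-upTo n))))

module Worpitzky where

  open import Data.Nat
  open import Data.Nat.Properties
  open import Data.Nat.ListAction using (sum)
  open import Data.Bool using (true; false; if_then_else_)
  open import Data.List using (List; []; _∷_; map; upTo; applyUpTo; length; cartesianProduct)
  open import Data.List.Properties using (map-applyUpTo; map-cong; map-cong-local)
  open import Data.List.Relation.Unary.All as All using (All; []; _∷_)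
  open import Data.List.Relation.Unary.Any using (here; there)
  open import Data.List.Relation.Unary.Unique.Propositional using (Unique)
  import Data.List.Relation.Unary.Unique.Propositional.Properties as Unique
  open import Data.List.Relation.Unary.AllPairs using ([]; _∷_)
  open import Data.List.Membership.Propositional using (_∈_; _∉_)
  open import Data.List.Membership.Propositional.Properties
    using (∈-upTo⁺; ∈-upTo⁻; ∈-cartesianProduct⁺; ∈-cartesianProduct⁻)
  open import Data.Product using (_,_; uncurry)
  open import Data.Sum using (_⊎_; inj₁; inj₂)
  open import Data.Empty using (⊥-elim)
  open import Function using (_∘_)
  open import Relation.Binary.PropositionalEquality
  open import Relation.Nullary using (yes; no)
  open import Defs using (allPerms; indexOf)
  open NatTests using (≡ᵇ-refl; ≢⇒≡ᵇ-false; ≡ᵇ-true⇒≡; ≡ᵇ-false⇒≢)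
  open Binomial using (riffles; riffles-insertion)
  open Descents using (des; des-≤; insertAt; sum-des-insertAt-max)
  open UniqueLists using (sum-reindex)
  open NatSums using (sum-map-*; sum-cartesianProduct)
  open Permutations

  delete : ℕ → List ℕ → List ℕ
  delete x [] = []
  delete x (y ∷ ys) = if y ≡ᵇ x then ys else y ∷ delete x ys

  delete-insertAt : ∀ x i τ → x ∉ τ → i ≤ length τ → delete x (insertAt i x τ) ≡ τ
  delete-insertAt x zero τ _ _ rewrite ≡ᵇ-refl x = refl
  delete-insertAt x (suc i) (y ∷ τ) x∉ (s≤s i≤) rewrite ≢⇒≡ᵇ-false {y} {x} (λ e → x∉ (here (sym e))) =
    cong (y ∷_) (delete-insertAt x i τ (x∉ ∘ there) i≤)

  indexOf-insertAt : ∀ x i τ → x ∉ τ → i ≤ length τ → indexOf x (insertAt i x τ) ≡ i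
  indexOf-insertAt x zero τ _ _ rewrite ≡ᵇ-refl x = refl
  indexOf-insertAt x (suc i) (y ∷ τ) x∉ (s≤s i≤) rewrite ≢⇒≡ᵇ-false {y} {x} (λ e → x∉ (here (sym e))) =
    cong suc (indexOf-insertAt x i τ (x∉ ∘ there) i≤)

  insertAt-indexOf-delete : ∀ x σ → x ∈ σ → insertAt (indexOf x σ) x (delete x σ) ≡ σ
  insertAt-indexOf-delete x (y ∷ σ) x∈ with y ≡ᵇ x in eq | x∈
  ... | true | _ = cong (_∷ σ) (sym (≡ᵇ-true⇒≡ eq))
  ... | false | here refl = ⊥-elim (≡ᵇ-false⇒≢ {y} eq refl)
  ... | false | there x∈σ = cong (y ∷_) (insertAt-indexOf-delete x σ x∈σ)

  length-delete : ∀ x σ → x ∈ σ → suc (length (delete x σ)) ≡ length σ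
  length-delete x (y ∷ σ) x∈ with y ≡ᵇ x in eq | x∈
  ... | true | _ = refl
  ... | false | here refl = ⊥-elim (≡ᵇ-false⇒≢ {y} eq refl)
  ... | false | there x∈σ = cong suc (length-delete x σ x∈σ)

  indexOf-< : ∀ x σ → x ∈ σ → indexOf x σ < length σ
  indexOf-< x (y ∷ σ) x∈ with y ≡ᵇ x in eq | x∈
  ... | true | _ = z<s
  ... | false | here refl = ⊥-elim (≡ᵇ-false⇒≢ {y} eq refl)
  ... | false | there x∈σ = s<s (indexOf-< x σ x∈σ)

  ∈-delete⁻ : ∀ x σ {y} → y ∈ delete x σ → y ∈ σ
  ∈-delete⁻ x (z ∷ σ) y∈ with z ≡ᵇ x | y∈
  ... | true | y∈σ = there y∈σ
  ... | false | here y≡z = here y≡z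
  ... | false | there y∈ = there (∈-delete⁻ x σ y∈)

  ∈-delete-≢ : ∀ x σ {y} → Unique σ → y ∈ delete x σ → y ≢ x
  ∈-delete-≢ x (z ∷ σ) (z∉σ ∷ σ!) y∈ with z ≡ᵇ x in eq | y∈
  ... | true | y∈σ = λ y≡x → All.lookup z∉σ y∈σ (trans (≡ᵇ-true⇒≡ eq) (sym y≡x))
  ... | false | here refl = ≡ᵇ-false⇒≢ eq
  ... | false | there y∈ = ∈-delete-≢ x σ σ! y∈

  ∈-delete⁺ : ∀ x σ {y} → y ∈ σ → y ≢ x → y ∈ delete x σ
  ∈-delete⁺ x (z ∷ σ) y∈ y≢x with z ≡ᵇ x in eq | y∈
  ... | true | here refl = ⊥-elim (y≢x (≡ᵇ-true⇒≡ eq))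
  ... | true | there y∈σ = y∈σ
  ... | false | here refl = here refl
  ... | false | there y∈σ = there (∈-delete⁺ x σ y∈σ y≢x)

  length-insertAt : ∀ i x τ → length (insertAt i x τ) ≡ suc (length τ)
  length-insertAt zero x τ = refl
  length-insertAt (suc i) x [] = refl
  length-insertAt (suc i) x (y ∷ τ) = cong suc (length-insertAt i x τ)

  ∈-insertAt⁻ : ∀ i x τ {y} → y ∈ insertAt i x τ → y ≡ x ⊎ y ∈ τ
  ∈-insertAt⁻ zero x τ (here e) = inj₁ e
  ∈-insertAt⁻ zero x τ (there y∈τ) = inj₂ y∈τ
  ∈-insertAt⁻ (suc i) x [] (here e) = inj₁ e
  ∈-insertAt⁻ (suc i) x (z ∷ τ) (here e) = inj₂ (here e)
  ∈-insertAt⁻ (suc i) x (z ∷ τ) (there y∈) with ∈-insertAt⁻ i x τ y∈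
  ... | inj₁ e = inj₁ e
  ... | inj₂ y∈τ = inj₂ (there y∈τ)

  ∈-insertAt-inserted : ∀ i x τ → x ∈ insertAt i x τ
  ∈-insertAt-inserted zero x τ = here refl
  ∈-insertAt-inserted (suc i) x [] = here refl
  ∈-insertAt-inserted (suc i) x (y ∷ τ) = there (∈-insertAt-inserted i x τ)

  ∈-insertAt⁺ : ∀ i x τ {y} → y ∈ τ → y ∈ insertAt i x τ
  ∈-insertAt⁺ zero x τ y∈τ = there y∈τ
  ∈-insertAt⁺ (suc i) x (z ∷ τ) (here e) = here e
  ∈-insertAt⁺ (suc i) x (z ∷ τ) (there y∈τ) = there (∈-insertAt⁺ i x τ y∈τ)

  IsPerm-delete : ∀ n σ → IsPerm (suc n) σ → IsPerm n (delete n σ)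
  IsPerm-delete n σ σ-perm@(|σ|≡ , σ< , covers) =
      suc-injective (trans (length-delete n σ n∈σ) |σ|≡)
    , All.tabulate (λ y∈ → ≤∧≢⇒< (≤-pred (All.lookup σ< (∈-delete⁻ n σ y∈))) (∈-delete-≢ n σ (IsPerm⇒Unique σ-perm) y∈))
    , λ j j<n → ∈-delete⁺ n σ (covers j (m≤n⇒m≤1+n j<n)) (λ j≡n → <-irrefl j≡n j<n)
    where
    n∈σ = covers n ≤-refl

  IsPerm-insertAt : ∀ n τ i → IsPerm n τ → IsPerm (suc n) (insertAt i n τ)
  IsPerm-insertAt n τ i (|τ|≡ , τ< , covers) =
      trans (length-insertAt i n τ) (cong suc |τ|≡)
    , All.tabulate (λ y∈ → bounded (∈-insertAt⁻ i n τ y∈))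
    , covers′
    where
    bounded : ∀ {y} → y ≡ n ⊎ y ∈ τ → y < suc n
    bounded (inj₁ refl) = ≤-refl
    bounded (inj₂ y∈τ) = m≤n⇒m≤1+n (All.lookup τ< y∈τ)
    covers′ : ∀ j → j < suc n → j ∈ insertAt i n τ
    covers′ j j< with j ≟ n
    ... | yes refl = ∈-insertAt-inserted i n τ
    ... | no j≢n = ∈-insertAt⁺ i n τ (covers j (≤∧≢⇒< (≤-pred j<) j≢n))

  -- σ ↦ (σ with n deleted, position of n) is a bijection 𝔖ₙ₊₁ ≅ 𝔖ₙ × {0,…,n}.
  sum-allPerms-suc : ∀ n (h : List ℕ → ℕ) →
    sum (map h (allPerms (suc n))) ≡ sum (map (λ τ → sum (applyUpTo (λ i → h (insertAt i n τ)) (suc n))) (allPerms n))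
  sum-allPerms-suc n h =
    trans (sum-reindex h (uncurry insert) (λ σ → delete n σ , indexOf n σ)
            (allPerms-unique (suc n)) (Unique.cartesianProduct⁺ (allPerms-unique n) (Unique.upTo⁺ (suc n)))
            insert∈ remove∈ (All.tabulate remove∘insert) insert∘remove)
          (trans (sum-cartesianProduct (λ τ i → h (insertAt i n τ)) (allPerms n) (upTo (suc n)))
                 (cong sum (map-cong (λ τ → cong sum (map-applyUpTo (λ i → i) (λ i → h (insertAt i n τ)) (suc n))) (allPerms n))))
    where
    insert : List ℕ → ℕ → List ℕ
    insert τ i = insertAt i n τ
    insert∈ : ∀ {p} → p ∈ cartesianProduct (allPerms n) (upTo (suc n)) → uncurry insert p ∈ allPerms (suc n)
    insert∈ {τ , i} p∈ with ∈-cartesianProduct⁻ (allPerms n) (upTo (suc n)) p∈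
    ... | τ∈ , i∈ = ∈-allPerms⁺ (IsPerm-insertAt n τ i (∈-allPerms⁻ τ∈))
    remove∈ : ∀ {σ} → σ ∈ allPerms (suc n) → (delete n σ , indexOf n σ) ∈ cartesianProduct (allPerms n) (upTo (suc n))
    remove∈ {σ} σ∈ with ∈-allPerms⁻ σ∈
    ... | σ-perm@(|σ|≡ , _ , covers) = ∈-cartesianProduct⁺ (∈-allPerms⁺ (IsPerm-delete n σ σ-perm))
      (∈-upTo⁺ (subst (indexOf n σ <_) |σ|≡ (indexOf-< n σ (covers n ≤-refl))))
    remove∘insert : ∀ {p} → p ∈ cartesianProduct (allPerms n) (upTo (suc n)) →
                    (delete n (uncurry insert p) , indexOf n (uncurry insert p)) ≡ p
    remove∘insert {τ , i} p∈ with ∈-cartesianProduct⁻ (allPerms n) (upTo (suc n)) p∈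
    ... | τ∈ , i∈ with ∈-allPerms⁻ τ∈
    ... | |τ|≡ , τ< , _ = cong₂ _,_ (delete-insertAt n i τ n∉τ i≤) (indexOf-insertAt n i τ n∉τ i≤)
      where
      n∉τ : n ∉ τ
      n∉τ n∈τ = <-irrefl refl (All.lookup τ< n∈τ)
      i≤ = subst (i ≤_) (sym |τ|≡) (≤-pred (∈-upTo⁻ i∈))
    insert∘remove : ∀ {σ} → σ ∈ allPerms (suc n) → insertAt (indexOf n σ) n (delete n σ) ≡ σ
    insert∘remove {σ} σ∈ with ∈-allPerms⁻ σ∈
    ... | _ , _ , covers = insertAt-indexOf-delete n σ (covers n ≤-refl)

  sum-riffles : ∀ a n → sum (map (riffles (suc a) n ∘ des) (allPerms n)) ≡ suc a ^ n
  sum-riffles a zero = refl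
  sum-riffles a (suc n) =
    begin
      sum (map (riffles (suc a) (suc n) ∘ des) (allPerms (suc n)))
    ≡⟨ sum-allPerms-suc n (riffles (suc a) (suc n) ∘ des) ⟩
      sum (map (λ τ → sum (applyUpTo (λ i → riffles (suc a) (suc n) (des (insertAt i n τ))) (suc n))) (allPerms n))
    ≡⟨ cong sum (map-cong-local (All.tabulate insertions)) ⟩
      sum (map (λ τ → suc a * riffles (suc a) n (des τ)) (allPerms n))
    ≡⟨ sum-map-* (suc a) (riffles (suc a) n ∘ des) (allPerms n) ⟩
      suc a * sum (map (riffles (suc a) n ∘ des) (allPerms n))
    ≡⟨ cong (suc a *_) (sum-riffles a n) ⟩
      suc a * suc a ^ n
    ∎
    where
    open ≡-Reasoning
    insertions : ∀ {τ} → τ ∈ allPerms n →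
      sum (applyUpTo (λ i → riffles (suc a) (suc n) (des (insertAt i n τ))) (suc n)) ≡ suc a * riffles (suc a) n (des τ)
    insertions {τ} τ∈ with ∈-allPerms⁻ {n} τ∈
    ... | refl , τ<n , _ = trans (sum-des-insertAt-max (riffles (suc a) (suc (length τ))) (length τ) τ τ<n)
                                  (riffles-insertion a (length τ) (des τ) (des-≤ τ))

module Inverse where

  open import Data.Nat
  open import Data.Nat.Properties
  open import Data.List using (List; []; _∷_; upTo; applyUpTo; length)
  open import Data.List.Properties using (map-applyUpTo; length-map; length-upTo)
  open import Data.List.Relation.Unary.All as All using (All)
  open import Data.List.Relation.Unary.Any using (here; there)
  open import Data.List.Relation.Unary.Unique.Propositional using (Unique)
  open import Data.List.Relation.Unary.AllPairs using (_∷_)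
  open import Data.List.Membership.Propositional using (_∈_)
  open import Data.Product using (_,_)
  open import Data.Bool using (true; false)
  open import Data.Empty using (⊥-elim)
  open import Function using (_∘_)
  open import Relation.Binary.PropositionalEquality
  open import Defs using (indexOf; inv)
  open NatTests using (≡ᵇ-refl; ≢⇒≡ᵇ-false; ≡ᵇ-true⇒≡; ≡ᵇ-false⇒≢)
  open Permutations using (IsPerm; IsPerm⇒Unique)

  -- junk value 0 out of range
  nth : List ℕ → ℕ → ℕ
  nth [] _ = 0
  nth (x ∷ xs) zero = x
  nth (x ∷ xs) (suc i) = nth xs i

  nth-ext : ∀ (xs ys : List ℕ) → length xs ≡ length ys → (∀ i → i < length xs → nth xs i ≡ nth ys i) → xs ≡ ys
  nth-ext [] [] _ _ = refl
  nth-ext (x ∷ xs) (y ∷ ys) |xs|≡ e = cong₂ _∷_ (e 0 z<s) (nth-ext xs ys (suc-injective |xs|≡) (λ i i< → e (suc i) (s<s i<)))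

  nth-applyUpTo : ∀ (f : ℕ → ℕ) n i → i < n → nth (applyUpTo f n) i ≡ f i
  nth-applyUpTo f (suc n) zero _ = refl
  nth-applyUpTo f (suc n) (suc i) (s<s i<n) = nth-applyUpTo (f ∘ suc) n i i<n

  nth-inv : ∀ σ j → j < length σ → nth (inv σ) j ≡ indexOf j σ
  nth-inv σ j j< = trans (cong (λ xs → nth xs j) (map-applyUpTo (λ i → i) (λ i → indexOf i σ) (length σ)))
                         (nth-applyUpTo (λ i → indexOf i σ) (length σ) j j<)

  nth-∈ : ∀ xs i → i < length xs → nth xs i ∈ xs
  nth-∈ (x ∷ xs) zero _ = here refl
  nth-∈ (x ∷ xs) (suc i) (s<s i<) = there (nth-∈ xs i i<)

  indexOf-first : ∀ x xs k → k < length xs → nth xs k ≡ x → (∀ k′ → k′ < k → nth xs k′ ≢ x) → indexOf x xs ≡ k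
  indexOf-first x (y ∷ xs) zero _ refl _ rewrite ≡ᵇ-refl y = refl
  indexOf-first x (y ∷ xs) (suc k) (s<s k<) e earlier rewrite ≢⇒≡ᵇ-false {y} {x} (earlier 0 z<s) =
    cong suc (indexOf-first x xs k k< e (λ k′ k′< → earlier (suc k′) (s<s k′<)))

  nth-indexOf : ∀ x xs → x ∈ xs → nth xs (indexOf x xs) ≡ x
  nth-indexOf x (y ∷ xs) x∈ with y ≡ᵇ x in eq | x∈
  ... | true | _ = ≡ᵇ-true⇒≡ eq
  ... | false | here refl = ⊥-elim (≡ᵇ-false⇒≢ {y} eq refl)
  ... | false | there x∈xs = nth-indexOf x xs x∈xs

  indexOf-nth : ∀ xs i → Unique xs → i < length xs → indexOf (nth xs i) xs ≡ i
  indexOf-nth (x ∷ xs) zero _ _ rewrite ≡ᵇ-refl x = refl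
  indexOf-nth (x ∷ xs) (suc i) (x∉xs ∷ xs!) (s<s i<) rewrite ≢⇒≡ᵇ-false {x} {nth xs i} (All.lookup x∉xs (nth-∈ xs i i<)) =
    cong suc (indexOf-nth xs i xs! i<)

  length-inv : ∀ σ → length (inv σ) ≡ length σ
  length-inv σ = trans (length-map _ (upTo (length σ))) (length-upTo (length σ))

  inv-involutive : ∀ {n π} → IsPerm n π → inv (inv π) ≡ π
  inv-involutive {n} {π} π-perm@(|π|≡n , π<n , covers) =
    nth-ext (inv (inv π)) π (trans (length-inv (inv π)) (length-inv π)) entry
    where
    |π⁻¹|≡n = trans (length-inv π) |π|≡n
    entry : ∀ i → i < length (inv (inv π)) → nth (inv (inv π)) i ≡ nth π i
    entry i i<|π⁻¹⁻¹| = trans (nth-inv (inv π) i i<|π⁻¹|) (indexOf-first i (inv π) (nth π i) πᵢ<|π⁻¹| π⁻¹[πᵢ]≡i earlier)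
      where
      i<|π⁻¹| = subst (i <_) (length-inv (inv π)) i<|π⁻¹⁻¹|
      i<|π| = subst (i <_) (length-inv π) i<|π⁻¹|
      πᵢ<n : nth π i < n
      πᵢ<n = All.lookup π<n (nth-∈ π i i<|π|)
      πᵢ<|π⁻¹| = subst (nth π i <_) (sym |π⁻¹|≡n) πᵢ<n
      π⁻¹[πᵢ]≡i : nth (inv π) (nth π i) ≡ i
      π⁻¹[πᵢ]≡i = trans (nth-inv π (nth π i) (subst (nth π i <_) (sym |π|≡n) πᵢ<n)) (indexOf-nth π i (IsPerm⇒Unique π-perm) i<|π|)
      earlier : ∀ k → k < nth π i → nth (inv π) k ≢ i
      earlier k k<πᵢ π⁻¹ₖ≡i = <-irrefl (sym πᵢ≡k) k<πᵢ
        where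
        k<n = <-trans k<πᵢ πᵢ<n
        πᵢ≡k : nth π i ≡ k
        πᵢ≡k = trans (cong (nth π) (sym (trans (sym (nth-inv π k (subst (k <_) (sym |π|≡n) k<n))) π⁻¹ₖ≡i)))
                     (nth-indexOf k π (covers k k<n))

module Compositions where

  open import Data.Nat
  open import Data.Nat.Properties
  open import Data.Nat.ListAction using (sum)
  open import Data.Bool using (Bool; true; false; if_then_else_; _∧_; _∨_)
  open import Data.Bool.ListAction using (all; any)
  open import Data.List using (List; []; _∷_; map; upTo; applyUpTo; length; _++_; drop; filterᵇ)
  open import Data.List.Properties using (map-applyUpTo; map-∘; map-id; map-cong; map-cong-local)
  open import Data.List.Relation.Unary.All as All using (All; []; _∷_)
  open import Data.List.Relation.Unary.All.Properties using (++⁺; map⁺)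
  open import Data.List.Relation.Unary.AllPairs using (AllPairs; []; _∷_)
  open import Data.List.Relation.Binary.Sublist.Propositional using (_⊆_; []; _∷_; _∷ʳ_)
  open import Data.List.Relation.Binary.Sublist.Propositional.Properties using (All-resp-⊆)
  open import Data.List.Relation.Binary.Sublist.Heterogeneous.Properties using (length-mono-≤)
  open import Data.List.Relation.Unary.Any using (here)
  open import Data.List.Membership.Propositional using (_∈_)
  open import Data.List.Membership.Propositional.Properties using (∈-map⁻)
  open import Data.Product using (_×_; _,_; ∃)
  open import Function using (_∘_)
  open import Relation.Binary.PropositionalEquality
  open import Defs using (co; comps; psums; leq; sublists; size; IsComp; descsFrom)
  open NatTests using (≡ᵇ-refl; ≢⇒≡ᵇ-false)
  open NatSums using (sum-map-++; sum-map-zero; sum-filterᵇ)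
  open Binomial using (binom)

  interval : ℕ → ℕ → List ℕ
  interval i zero = []
  interval i (suc k) = i ∷ interval (suc i) k

  interval-increasing : ∀ i k → AllPairs _<_ (interval i k)
  interval-increasing i zero = []
  interval-increasing i (suc k) = above (suc i) k ≤-refl ∷ interval-increasing (suc i) k
    where
    above : ∀ j k → i < j → All (i <_) (interval j k)
    above j zero _ = []
    above j (suc k) i<j = i<j ∷ above (suc j) k (m≤n⇒m≤1+n i<j)

  interval-≥ : ∀ i k → All (i ≤_) (interval i k)
  interval-≥ i k = from i k ≤-refl
    where
    from : ∀ j k → i ≤ j → All (i ≤_) (interval j k)
    from j zero _ = []
    from j (suc k) i≤j = i≤j ∷ from (suc j) k (m≤n⇒m≤1+n i≤j)

  interval-< : ∀ i k → All (_< i + k) (interval i k)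
  interval-< i zero = []
  interval-< i (suc k) rewrite +-suc i k = s≤s (m≤m+n i k) ∷ interval-< (suc i) k

  length-interval : ∀ i k → length (interval i k) ≡ k
  length-interval i zero = refl
  length-interval i (suc k) = cong suc (length-interval (suc i) k)

  applyUpTo≡interval : ∀ (f : ℕ → ℕ) i k → (∀ j → f j ≡ i + j) → applyUpTo f k ≡ interval i k
  applyUpTo≡interval f i zero _ = refl
  applyUpTo≡interval f i (suc k) f≗i+ =
    cong₂ _∷_ (trans (f≗i+ 0) (+-identityʳ i)) (applyUpTo≡interval (f ∘ suc) (suc i) k (λ j → trans (f≗i+ (suc j)) (+-suc i j)))

  map-suc-upTo : ∀ m → map suc (upTo m) ≡ interval 1 m
  map-suc-upTo m = trans (map-applyUpTo (λ x → x) suc m) (applyUpTo≡interval suc 1 m (λ _ → refl))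

  AllPairs-resp-⊆ : ∀ {R : ℕ → ℕ → Set} {xs ys} → xs ⊆ ys → AllPairs R ys → AllPairs R xs
  AllPairs-resp-⊆ [] [] = []
  AllPairs-resp-⊆ (y ∷ʳ xs⊆ys) (_ ∷ ys-pairs) = AllPairs-resp-⊆ xs⊆ys ys-pairs
  AllPairs-resp-⊆ (refl ∷ xs⊆ys) (y-rel ∷ ys-pairs) = All-resp-⊆ xs⊆ys y-rel ∷ AllPairs-resp-⊆ xs⊆ys ys-pairs

  sublists-⊆ : ∀ xs → All (_⊆ xs) (sublists xs)
  sublists-⊆ [] = [] ∷ []
  sublists-⊆ (x ∷ xs) = ++⁺ (map⁺ (All.map keep (sublists-⊆ xs))) (All.map skip (sublists-⊆ xs))
    where
    keep : ∀ {t : List ℕ} → t ⊆ xs → x ∷ t ⊆ x ∷ xs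
    keep = refl ∷_
    skip : ∀ {t : List ℕ} → t ⊆ xs → t ⊆ x ∷ xs
    skip = x ∷ʳ_

  descsFrom-⊆ : ∀ i w → descsFrom i w ⊆ interval i (length w ∸ 1)
  descsFrom-⊆ i [] = []
  descsFrom-⊆ i (x ∷ []) = []
  descsFrom-⊆ i (x ∷ y ∷ ys) = head-or-not (y <ᵇ x) (descsFrom-⊆ (suc i) (y ∷ ys))
    where
    head-or-not : ∀ b {ds is} → ds ⊆ is → (if b then i ∷ [] else []) ++ ds ⊆ i ∷ is
    head-or-not true ds⊆ = refl ∷ ds⊆
    head-or-not false ds⊆ = i ∷ʳ ds⊆

  -- The loop of co, which is local to its definition: for 0 < s₁ < … < s_k ≤ m,
  -- coFrom m p (s₁ ∷ … ∷ s_k) = (s₁ - p, s₂ - s₁, …, suc m - s_k).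
  coFrom : ℕ → ℕ → List ℕ → List ℕ
  coFrom m p ss = drop 1 (co (suc m) (p ∷ ss))

  co≡coFrom : ∀ m T → co (suc m) T ≡ coFrom m 0 T
  co≡coFrom m [] = refl
  co≡coFrom m (s ∷ ss) = refl

  length-coFrom : ∀ m p ss → length (coFrom m p ss) ≡ suc (length ss)
  length-coFrom m p [] = refl
  length-coFrom m p (s ∷ ss) = cong suc (length-coFrom m s ss)

  private
    telescope : ∀ {p s t} → p ≤ s → s ≤ t → (s ∸ p) + (t ∸ s) ≡ t ∸ p
    telescope {p} {s} {t} p≤s s≤t = sym (trans (cong (_∸ p) (sym (m+[n∸m]≡n s≤t))) (+-∸-comm (t ∸ s) p≤s))

  psums-coFrom : ∀ m p ss → All (p <_) ss → AllPairs _<_ ss → psums (coFrom m p ss) ≡ map (_∸ p) ss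
  psums-coFrom m p [] _ _ = refl
  psums-coFrom m p (s ∷ []) _ _ = refl
  psums-coFrom m p (s ∷ t ∷ ss) (p<s ∷ _) (s<t∷ss ∷ t∷ss-incr) = cong ((s ∸ p) ∷_)
    (trans (cong (map ((s ∸ p) +_)) (psums-coFrom m s (t ∷ ss) s<t∷ss t∷ss-incr))
    (trans (sym (map-∘ (t ∷ ss))) (map-cong-local (All.map (λ s<u → telescope (<⇒≤ p<s) (<⇒≤ s<u)) s<t∷ss))))

  size-coFrom : ∀ m p ss → p ≤ m → All (p <_) ss → AllPairs _<_ ss → All (_≤ m) ss → size (coFrom m p ss) ≡ suc m ∸ p
  size-coFrom m p [] _ _ _ _ = +-identityʳ (suc m ∸ p)
  size-coFrom m p (s ∷ ss) _ (p<s ∷ _) (s<ss ∷ ss-incr) (s≤m ∷ ss≤m) =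
    trans (cong ((s ∸ p) +_) (size-coFrom m s ss s≤m s<ss ss-incr ss≤m)) (telescope (<⇒≤ p<s) (m≤n⇒m≤1+n s≤m))

  coFrom-IsComp : ∀ m p ss → p ≤ m → All (p <_) ss → AllPairs _<_ ss → All (_≤ m) ss → IsComp (coFrom m p ss)
  coFrom-IsComp m p [] p≤m _ _ _ = subst (0 <_) (sym (+-∸-assoc 1 p≤m)) z<s ∷ []
  coFrom-IsComp m p (s ∷ ss) _ (p<s ∷ _) (s<ss ∷ ss-incr) (s≤m ∷ ss≤m) =
    m<n⇒0<n∸m p<s ∷ coFrom-IsComp m s ss s≤m s<ss ss-incr ss≤m

  private
    cuts-increasing : ∀ {m T} → T ⊆ interval 1 m → AllPairs _<_ T
    cuts-increasing {m} T⊆ = AllPairs-resp-⊆ T⊆ (interval-increasing 1 m)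

    cuts-positive : ∀ {m T} → T ⊆ interval 1 m → All (0 <_) T
    cuts-positive {m} T⊆ = All-resp-⊆ T⊆ (interval-≥ 1 m)

    cuts-≤ : ∀ {m T} → T ⊆ interval 1 m → All (_≤ m) T
    cuts-≤ {m} T⊆ = All-resp-⊆ T⊆ (All.map ≤-pred (interval-< 1 m))

  psums-co : ∀ m {T} → T ⊆ interval 1 m → psums (co (suc m) T) ≡ T
  psums-co m {T} T⊆ =
    trans (cong psums (co≡coFrom m T)) (trans (psums-coFrom m 0 T (cuts-positive T⊆) (cuts-increasing T⊆)) (map-id T))

  length-co : ∀ m T → length (co (suc m) T) ≡ suc (length T)
  length-co m T = trans (cong length (co≡coFrom m T)) (length-coFrom m 0 T)

  size-co : ∀ m {T} → T ⊆ interval 1 m → size (co (suc m) T) ≡ suc m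
  size-co m {T} T⊆ =
    trans (cong size (co≡coFrom m T)) (size-coFrom m 0 T z≤n (cuts-positive T⊆) (cuts-increasing T⊆) (cuts-≤ T⊆))

  co-IsComp : ∀ m {T} → T ⊆ interval 1 m → IsComp (co (suc m) T)
  co-IsComp m {T} T⊆ =
    subst IsComp (sym (co≡coFrom m T)) (coFrom-IsComp m 0 T z≤n (cuts-positive T⊆) (cuts-increasing T⊆) (cuts-≤ T⊆))

  comps-suc : ∀ m → comps (suc m) ≡ map (co (suc m)) (sublists (interval 1 m))
  comps-suc m = cong (λ X → map (co (suc m)) (sublists X)) (map-suc-upTo m)

  ∈-comps⁻ : ∀ n {β} → β ∈ comps n → ∃ λ T → β ≡ co n T
  ∈-comps⁻ n β∈ with ∈-map⁻ (co n) β∈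
  ... | T , _ , β≡ = T , β≡

  comps-size×IsComp : ∀ n {β} → β ∈ comps n → size β ≡ n × IsComp β
  comps-size×IsComp zero (here refl) = refl , []
  comps-size×IsComp (suc m) β∈ rewrite comps-suc m with ∈-map⁻ (co (suc m)) β∈
  ... | T , T∈ , refl = size-co m T⊆ , co-IsComp m T⊆
    where T⊆ = All.lookup (sublists-⊆ (interval 1 m)) T∈

  isSubset : List ℕ → List ℕ → Bool
  isSubset S T = all (λ s → any (s ≡ᵇ_) T) S

  leq-co : ∀ m {S T} → S ⊆ interval 1 m → T ⊆ interval 1 m → leq (co (suc m) S) (co (suc m) T) ≡ isSubset S T
  leq-co m S⊆ T⊆ = cong₂ (λ S′ T′ → all (λ s → any (s ≡ᵇ_) T′) S′) (psums-co m S⊆) (psums-co m T⊆)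

  private
    all-cong : ∀ {p q : ℕ → Bool} S → All (λ s → p s ≡ q s) S → all p S ≡ all q S
    all-cong [] [] = refl
    all-cong (s ∷ S) (e ∷ es) = cong₂ _∧_ e (all-cong S es)

    any-≡ᵇ-< : ∀ x T → All (x <_) T → any (x ≡ᵇ_) T ≡ false
    any-≡ᵇ-< x [] [] = refl
    any-≡ᵇ-< x (t ∷ T) (x<t ∷ x<T) rewrite ≢⇒≡ᵇ-false (<⇒≢ x<t) = any-≡ᵇ-< x T x<T

    isSubset-∷ʳ : ∀ x S T → All (x <_) S → isSubset S (x ∷ T) ≡ isSubset S T
    isSubset-∷ʳ x S T x<S = all-cong S (All.map (λ {s} x<s → cong (_∨ any (s ≡ᵇ_) T) (≢⇒≡ᵇ-false (≢-sym (<⇒≢ x<s)))) x<S)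

  sum-binom-supersets : ∀ b c {S X} → S ⊆ X → AllPairs _<_ X →
    sum (map (λ T → if isSubset S T then binom b (length T + c) else 0) (sublists X)) ≡ binom (b + length X ∸ length S) (length X + c)
  sum-binom-supersets b c [] _ = trans (+-identityʳ _) (cong (λ z → binom z c) (sym (+-identityʳ b)))
  sum-binom-supersets b c {S} {x ∷ X} (.x ∷ʳ S⊆X) (x<X ∷ X-incr) =
    begin
      sum (map h (map (x ∷_) (sublists X) ++ sublists X))
    ≡⟨ sum-map-++ h (map (x ∷_) (sublists X)) (sublists X) ⟩
      sum (map h (map (x ∷_) (sublists X))) + sum (map h (sublists X))
    ≡⟨ cong (_+ sum (map h (sublists X))) (trans (cong sum (sym (map-∘ (sublists X)))) (cong sum (map-cong (λ T → with-x {T}) (sublists X)))) ⟩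
      sum (map (λ T → if isSubset S T then binom b (length T + suc c) else 0) (sublists X)) + sum (map h (sublists X))
    ≡⟨ cong₂ _+_ (sum-binom-supersets b (suc c) S⊆X X-incr) (sum-binom-supersets b c S⊆X X-incr) ⟩
      binom N (length X + suc c) + binom N (length X + c)
    ≡⟨ trans (cong (λ z → binom N z + binom N (length X + c)) (+-suc (length X) c)) (+-comm (binom N (suc (length X + c))) _) ⟩
      binom (suc N) (suc (length X + c))
    ≡⟨ cong (λ z → binom z (suc (length X + c))) (sym b+|x∷X|∸|S|) ⟩
      binom (b + suc (length X) ∸ length S) (suc (length X) + c)
    ∎
    where
    open ≡-Reasoning
    h = λ T → if isSubset S T then binom b (length T + c) else 0
    N = b + length X ∸ length S
    b+|x∷X|∸|S| : b + suc (length X) ∸ length S ≡ suc N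
    b+|x∷X|∸|S| = trans (cong (_∸ length S) (+-suc b (length X))) (+-∸-assoc 1 (≤-trans (length-mono-≤ S⊆X) (m≤n+m (length X) b)))
    with-x : ∀ {T} → h (x ∷ T) ≡ (if isSubset S T then binom b (length T + suc c) else 0)
    with-x {T} rewrite isSubset-∷ʳ x S T (All-resp-⊆ S⊆X x<X) = cong (λ z → if isSubset S T then binom b z else 0) (sym (+-suc (length T) c))
  sum-binom-supersets b c {x ∷ S} {x ∷ X} (refl ∷ S⊆X) (x<X ∷ X-incr) =
    begin
      sum (map h (map (x ∷_) (sublists X) ++ sublists X))
    ≡⟨ sum-map-++ h (map (x ∷_) (sublists X)) (sublists X) ⟩
      sum (map h (map (x ∷_) (sublists X))) + sum (map h (sublists X))
    ≡⟨ cong₂ _+_ (trans (cong sum (sym (map-∘ (sublists X)))) (cong sum (map-cong (λ T → with-x {T}) (sublists X))))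
                 (sum-map-zero h (sublists X) (All.map without-x (sublists-⊆ X))) ⟩
      sum (map (λ T → if isSubset S T then binom b (length T + suc c) else 0) (sublists X)) + 0
    ≡⟨ +-identityʳ _ ⟩
      sum (map (λ T → if isSubset S T then binom b (length T + suc c) else 0) (sublists X))
    ≡⟨ sum-binom-supersets b (suc c) S⊆X X-incr ⟩
      binom (b + length X ∸ length S) (length X + suc c)
    ≡⟨ cong₂ binom (sym (cong (_∸ suc (length S)) (+-suc b (length X)))) (+-suc (length X) c) ⟩
      binom (b + suc (length X) ∸ suc (length S)) (suc (length X) + c)
    ∎
    where
    open ≡-Reasoning
    h = λ T → if isSubset (x ∷ S) T then binom b (length T + c) else 0
    with-x : ∀ {T} → h (x ∷ T) ≡ (if isSubset S T then binom b (length T + suc c) else 0)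
    with-x {T} rewrite ≡ᵇ-refl x | isSubset-∷ʳ x S T (All-resp-⊆ S⊆X x<X) =
      cong (λ z → if isSubset S T then binom b z else 0) (sym (+-suc (length T) c))
    without-x : ∀ {T} → T ⊆ X → h T ≡ 0
    without-x {T} T⊆X rewrite any-≡ᵇ-< x T (All-resp-⊆ T⊆X x<X) = refl

  sum-binom-length-refinements : ∀ a m {S} → S ⊆ interval 1 m →
    sum (map (binom a ∘ length) (filterᵇ (leq (co (suc m) S)) (comps (suc m)))) ≡ binom (a + m ∸ length S) (m + 1)
  sum-binom-length-refinements a m {S} S⊆ rewrite comps-suc m =
    begin
      sum (map (binom a ∘ length) (filterᵇ (leq (co (suc m) S)) (map (co (suc m)) (sublists X))))
    ≡⟨ sum-filterᵇ (leq (co (suc m) S)) (binom a ∘ length) (map (co (suc m)) (sublists X)) ⟩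
      sum (map (λ β → if leq (co (suc m) S) β then binom a (length β) else 0) (map (co (suc m)) (sublists X)))
    ≡⟨ cong sum (sym (map-∘ (sublists X))) ⟩
      sum (map (λ T → if leq (co (suc m) S) (co (suc m) T) then binom a (length (co (suc m) T)) else 0) (sublists X))
    ≡⟨ cong sum (map-cong-local (All.map by-cuts (sublists-⊆ X))) ⟩
      sum (map (λ T → if isSubset S T then binom a (length T + 1) else 0) (sublists X))
    ≡⟨ sum-binom-supersets a 1 S⊆ (interval-increasing 1 m) ⟩
      binom (a + length X ∸ length S) (length X + 1)
    ≡⟨ cong (λ k → binom (a + k ∸ length S) (k + 1)) (length-interval 1 m) ⟩
      binom (a + m ∸ length S) (m + 1)
    ∎
    where
    open ≡-Reasoning
    X = interval 1 m
    by-cuts : ∀ {T} → T ⊆ X → (if leq (co (suc m) S) (co (suc m) T) then binom a (length (co (suc m) T)) else 0)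
                             ≡ (if isSubset S T then binom a (length T + 1) else 0)
    by-cuts {T} T⊆ = cong₂ (λ b k → if b then binom a k else 0) (leq-co m S⊆ T⊆) (trans (length-co m T) (+-comm 1 (length T)))

module QuasisymmetricEvaluation where

  open import Data.Nat as ℕ using (ℕ; zero; suc)
  open import Data.Nat.ListAction using (sum)
  open import Data.Bool using (Bool; true; false; if_then_else_)
  open import Data.List using ([]; _∷_; map; length; _++_; filterᵇ; replicate)
  open import Data.List.Properties using (map-∘; map-cong; map-cong-local)
  open import Data.List.Membership.Propositional using (_∈_)
  open import Data.List.Membership.Propositional.Properties using (∈-filter⁻)
  open import Relation.Nullary.Decidable using (T?)
  open import Data.List.Relation.Unary.All as All using (All; []; _∷_)
  open import Data.Product using (_,_; proj₁; proj₂)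
  open import Data.Rational using (ℚ; 0ℚ; 1ℚ; _+_; _*_)
  open import Data.Rational.Properties
  open import Function using (_∘_)
  open import Relation.Binary.PropositionalEquality
  open import Defs
  open NatToRational using (toℚ; toℚ-+)
  open Binomial using (binom)
  open Compositions using (comps-size×IsComp)

  sumℚ-++ : ∀ xs ys → sumℚ (xs ++ ys) ≡ sumℚ xs + sumℚ ys
  sumℚ-++ [] ys = sym (+-identityˡ (sumℚ ys))
  sumℚ-++ (x ∷ xs) ys = trans (cong (x +_) (sumℚ-++ xs ys)) (sym (+-assoc x (sumℚ xs) (sumℚ ys)))

  sumℚ-zero : ∀ xs → All (_≡ 0ℚ) xs → sumℚ xs ≡ 0ℚ
  sumℚ-zero [] [] = refl
  sumℚ-zero (x ∷ xs) (refl ∷ xs≡0) = trans (+-identityˡ (sumℚ xs)) (sumℚ-zero xs xs≡0)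

  sumℚ-toℚ : ∀ ms → sumℚ (map toℚ ms) ≡ toℚ (sum ms)
  sumℚ-toℚ [] = refl
  sumℚ-toℚ (m ∷ ms) = trans (cong (toℚ m +_) (sumℚ-toℚ ms)) (sym (toℚ-+ m (sum ms)))

  sumℚ-*ʳ : ∀ xs q → sumℚ (map (_* q) xs) ≡ sumℚ xs * q
  sumℚ-*ʳ [] q = sym (*-zeroˡ q)
  sumℚ-*ʳ (x ∷ xs) q = trans (cong (x * q +_) (sumℚ-*ʳ xs q)) (sym (*-distribʳ-+ q x (sumℚ xs)))

  sumℚ-filterᵇ : ∀ {A : Set} (p : A → Bool) (g : A → ℚ) xs →
    sumℚ (map g (filterᵇ p xs)) ≡ sumℚ (map (λ x → if p x then g x else 0ℚ) xs)
  sumℚ-filterᵇ p g [] = refl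
  sumℚ-filterᵇ p g (x ∷ xs) with p x
  ... | true = cong (g x +_) (sumℚ-filterᵇ p g xs)
  ... | false = trans (sumℚ-filterᵇ p g xs) (sym (+-identityˡ _))

  powℚ-1ℚ : ∀ k → powℚ 1ℚ k ≡ 1ℚ
  powℚ-1ℚ zero = refl
  powℚ-1ℚ (suc k) = trans (*-identityˡ (powℚ 1ℚ k)) (powℚ-1ℚ k)

  powℚ-+ : ∀ x m k → powℚ x (m ℕ.+ k) ≡ powℚ x m * powℚ x k
  powℚ-+ x zero k = sym (*-identityˡ _)
  powℚ-+ x (suc m) k = trans (cong (x *_) (powℚ-+ x m k)) (sym (*-assoc x _ _))

  evalM-1-[b] : ∀ b → evalM (1ℚ ∷ []) (b ∷ []) ≡ 1ℚ
  evalM-1-[b] b = trans (+-identityʳ (powℚ 1ℚ b * 1ℚ)) (trans (*-identityʳ (powℚ 1ℚ b)) (powℚ-1ℚ b))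

  evalM-1-long : ∀ b x β → evalM (1ℚ ∷ []) (b ∷ x ∷ β) ≡ 0ℚ
  evalM-1-long b x β = trans (+-identityʳ (powℚ 1ℚ b * 0ℚ)) (*-zeroʳ (powℚ 1ℚ b))

  ζ-M : ∀ β → ζ (M β) ≡ evalM (1ℚ ∷ []) β
  ζ-M β = trans (+-identityʳ (1ℚ * evalM (1ℚ ∷ []) β)) (*-identityˡ (evalM (1ℚ ∷ []) β))

  -- ζ kills every M_γ with two or more parts, so among the deconcatenations
  -- b ∷ β = (b ∷ γ) · δ only γ = [] survives.
  ζpowM-nonempty-first : ∀ a b β →
    sumℚ (map (λ s → ζ (M (proj₁ s)) * ζpowM a (proj₂ s)) (map (λ p → (b ∷ proj₁ p , proj₂ p)) (splits β))) ≡ ζpowM a β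
  ζpowM-nonempty-first a b [] =
    trans (+-identityʳ _) (trans (cong (_* ζpowM a []) (trans (ζ-M (b ∷ [])) (evalM-1-[b] b))) (*-identityˡ (ζpowM a [])))
  ζpowM-nonempty-first a b (x ∷ β) = trans
    (cong₂ _+_ (trans (cong (_* ζpowM a (x ∷ β)) (trans (ζ-M (b ∷ [])) (evalM-1-[b] b))) (*-identityˡ (ζpowM a (x ∷ β))))
               (sumℚ-zero _ (longer (splits β))))
    (+-identityʳ (ζpowM a (x ∷ β)))
    where
    longer : ∀ ps → All (_≡ 0ℚ) (map (λ s → ζ (M (proj₁ s)) * ζpowM a (proj₂ s))
                                   (map (λ p → (b ∷ proj₁ p , proj₂ p)) (map (λ p → (x ∷ proj₁ p , proj₂ p)) ps)))
    longer [] = []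
    longer ((γ , δ) ∷ ps) =
      trans (cong (_* ζpowM a δ) (trans (ζ-M (b ∷ x ∷ γ)) (evalM-1-long b x γ))) (*-zeroˡ (ζpowM a δ)) ∷ longer ps

  ζpowM≡binom : ∀ a β → ζpowM a β ≡ toℚ (binom a (length β))
  ζpowM≡binom zero [] = refl
  ζpowM≡binom zero (b ∷ β) = refl
  ζpowM≡binom (suc a) [] = trans (+-identityʳ (ζ (M []) * ζpowM a [])) (trans (*-identityˡ (ζpowM a [])) (ζpowM≡binom a []))
  ζpowM≡binom (suc a) (b ∷ β) =
    trans (cong₂ _+_ (trans (*-identityˡ (ζpowM a (b ∷ β))) (ζpowM≡binom a (b ∷ β)))
                     (trans (ζpowM-nonempty-first a b β) (ζpowM≡binom a β)))
    (trans (+-comm (toℚ (binom a (suc (length β)))) (toℚ (binom a (length β))))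
           (sym (toℚ-+ (binom a (length β)) (binom a (suc (length β))))))

  evalM-replicate : ∀ a x β → evalM (replicate a x) β ≡ toℚ (binom a (length β)) * powℚ x (size β)
  evalM-replicate zero x [] = refl
  evalM-replicate zero x (b ∷ β) = sym (*-zeroˡ (powℚ x (b ℕ.+ size β)))
  evalM-replicate (suc a) x [] = refl
  evalM-replicate (suc a) x (b ∷ β) =
    begin
      powℚ x b * evalM (replicate a x) β + evalM (replicate a x) (b ∷ β)
    ≡⟨ cong₂ _+_ (cong (powℚ x b *_) (evalM-replicate a x β)) (evalM-replicate a x (b ∷ β)) ⟩
      powℚ x b * (toℚ B₀ * powℚ x (size β)) + toℚ B₁ * xⁿ
    ≡⟨ cong (_+ toℚ B₁ * xⁿ) (x^b-absorbed) ⟩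
      toℚ B₀ * xⁿ + toℚ B₁ * xⁿ
    ≡⟨ sym (*-distribʳ-+ xⁿ (toℚ B₀) (toℚ B₁)) ⟩
      (toℚ B₀ + toℚ B₁) * xⁿ
    ≡⟨ cong (_* xⁿ) (sym (toℚ-+ B₀ B₁)) ⟩
      toℚ (B₀ ℕ.+ B₁) * xⁿ
    ∎
    where
    open ≡-Reasoning
    B₀ = binom a (length β)
    B₁ = binom a (suc (length β))
    xⁿ = powℚ x (b ℕ.+ size β)
    x^b-absorbed : powℚ x b * (toℚ B₀ * powℚ x (size β)) ≡ toℚ B₀ * xⁿ
    x^b-absorbed = trans (sym (*-assoc (powℚ x b) (toℚ B₀) _))
      (trans (cong (_* powℚ x (size β)) (*-comm (powℚ x b) (toℚ B₀)))
      (trans (*-assoc (toℚ B₀) (powℚ x b) _) (cong (toℚ B₀ *_) (sym (powℚ-+ x b (size β))))))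

  ζpow-F : ∀ a α → ζpow a (F α) ≡ toℚ (sum (map (binom a ∘ length) (filterᵇ (leq α) (comps (size α)))))
  ζpow-F a α = begin
      sumℚ (map (λ p → proj₁ p * ζpowM a (proj₂ p)) (map (1ℚ ,_) L))
    ≡⟨ cong sumℚ (sym (map-∘ L)) ⟩
      sumℚ (map (λ β → 1ℚ * ζpowM a β) L)
    ≡⟨ cong sumℚ (map-cong (λ β → trans (*-identityˡ (ζpowM a β)) (ζpowM≡binom a β)) L) ⟩
      sumℚ (map (toℚ ∘ binom a ∘ length) L)
    ≡⟨ cong sumℚ (map-∘ L) ⟩
      sumℚ (map toℚ (map (binom a ∘ length) L))
    ≡⟨ sumℚ-toℚ (map (binom a ∘ length) L) ⟩
      toℚ (sum (map (binom a ∘ length) L))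
    ∎
    where
    open ≡-Reasoning
    L = filterᵇ (leq α) (comps (size α))

  evalF-replicate : ∀ a x α →
    evalF (replicate a x) α ≡ toℚ (sum (map (binom a ∘ length) (filterᵇ (leq α) (comps (size α))))) * powℚ x (size α)
  evalF-replicate a x α = begin
      sumℚ (map (λ p → proj₁ p * evalM (replicate a x) (proj₂ p)) (map (1ℚ ,_) L))
    ≡⟨ cong sumℚ (sym (map-∘ L)) ⟩
      sumℚ (map (λ β → 1ℚ * evalM (replicate a x) β) L)
    ≡⟨ cong sumℚ (map-cong-local (All.tabulate term)) ⟩
      sumℚ (map (λ β → toℚ (binom a (length β)) * powℚ x (size α)) L)
    ≡⟨ cong sumℚ (map-∘ L) ⟩
      sumℚ (map (_* powℚ x (size α)) (map (toℚ ∘ binom a ∘ length) L))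
    ≡⟨ sumℚ-*ʳ (map (toℚ ∘ binom a ∘ length) L) (powℚ x (size α)) ⟩
      sumℚ (map (toℚ ∘ binom a ∘ length) L) * powℚ x (size α)
    ≡⟨ cong (_* powℚ x (size α)) (trans (cong sumℚ (map-∘ L)) (sumℚ-toℚ (map (binom a ∘ length) L))) ⟩
      toℚ (sum (map (binom a ∘ length) L)) * powℚ x (size α)
    ∎
    where
    open ≡-Reasoning
    L = filterᵇ (leq α) (comps (size α))
    term : ∀ {β} → β ∈ L → 1ℚ * evalM (replicate a x) β ≡ toℚ (binom a (length β)) * powℚ x (size α)
    term {β} β∈ = trans (*-identityˡ (evalM (replicate a x) β)) (trans (evalM-replicate a x β)
      (cong (λ k → toℚ (binom a (length β)) * powℚ x k)
            (proj₁ (comps-size×IsComp (size α) (proj₁ (∈-filter⁻ (T? ∘ leq α) {xs = comps (size α)} β∈))))))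

module ShuffleCoefficients where

  open import Data.Nat as ℕ using (ℕ; zero; suc; z≤n; s≤s; _^_; NonZero)
  open import Data.Nat.Properties using (+-identityʳ; +-comm; ∸-+-assoc; m^n≢0)
  open import Data.Nat.ListAction using (sum)
  open import Data.Nat.Combinatorics using (_C_)
  open import Data.Integer using (+_)
  open import Data.Bool using (true; false; if_then_else_; _∧_)
  open import Data.Bool.Properties using (∧-zeroʳ)
  open import Data.List using (List; []; _∷_; map; length; _++_; filterᵇ; replicate)
  open import Data.List.Properties using (map-∘; map-++; map-cong-local)
  open import Data.List.Relation.Unary.All as All using (All; []; _∷_)
  open import Data.List.Relation.Unary.All.Properties using (++⁺; map⁺)
  open import Data.List.Relation.Binary.Sublist.Heterogeneous using (minimum; [])
  open import Data.List.Relation.Binary.Sublist.Propositional using (_⊆_)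
  open import Data.List.Membership.Propositional using (_∈_)
  open import Data.List.Membership.Propositional.Properties using (∈-filter⁻)
  open import Data.Product using (_,_; proj₁; proj₂)
  open import Data.Rational using (ℚ; 0ℚ; 1ℚ; _+_; _*_; _/_)
  open import Data.Rational.Properties using (+-identityˡ; *-identityʳ; *-zeroʳ; *-comm; /-cong)
  import Data.Rational.Properties as ℚ
  open import Function using (_∘_)
  open import Relation.Binary.PropositionalEquality
  open import Relation.Nullary.Decidable using (T?)
  open import Defs
  open NatTests using (≡ᵇ-refl)
  open NatToRational
  open Binomial using (binom; binom≡C; riffles)
  open Descents using (des; length-descsFrom)
  open Permutations using (IsPerm; ∈-allPerms⁻)
  open Worpitzky using (sum-riffles)
  open Inverse using (inv-involutive; length-inv)
  open Compositions
  open QuasisymmetricEvaluation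

  Homogeneous : ℕ → Elt → Set
  Homogeneous n G = All (λ p → proj₂ p ∈ comps n) G

  private
    evalM-1-two-parts : ∀ m s y ys → evalM (1ℚ ∷ []) (s ∷ y ∷ ys) ≡ (if (s ∷ y ∷ ys) == single (suc m) then 1ℚ else 0ℚ)
    evalM-1-two-parts m s y ys rewrite ∧-zeroʳ (s ℕ.≡ᵇ suc m) = evalM-1-long s y ys

  evalM-1-co : ∀ n T → evalM (1ℚ ∷ []) (co n T) ≡ (if co n T == single n then 1ℚ else 0ℚ)
  evalM-1-co zero T = refl
  evalM-1-co (suc m) [] rewrite ≡ᵇ-refl m = evalM-1-[b] (suc m)
  evalM-1-co (suc m) (s ∷ []) = evalM-1-two-parts m s (suc m ℕ.∸ s) []
  evalM-1-co (suc m) (s ∷ t ∷ ss) = evalM-1-two-parts m s (t ℕ.∸ s) (coFrom m t ss)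

  coeff-single≡ζ : ∀ n G → Homogeneous n G → coeff (single n) G ≡ ζ G
  coeff-single≡ζ n G G-hom = cong sumℚ (map-cong-local (All.map term G-hom))
    where
    term : ∀ {p} → proj₂ p ∈ comps n → (if proj₂ p == single n then proj₁ p else 0ℚ) ≡ proj₁ p * evalM (1ℚ ∷ []) (proj₂ p)
    term {q , β} β∈ with ∈-comps⁻ n β∈
    ... | T , refl = sym (trans (cong (q *_) (evalM-1-co n T)) (scale-indicator (co n T == single n)))
      where
      scale-indicator : ∀ b → q * (if b then 1ℚ else 0ℚ) ≡ (if b then q else 0ℚ)
      scale-indicator true = *-identityʳ q
      scale-indicator false = *-zeroʳ q

  F-Homogeneous : ∀ α → Homogeneous (size α) (F α)
  F-Homogeneous α = map⁺ (All.tabulate (λ β∈ → proj₁ (∈-filter⁻ (T? ∘ leq α) {xs = comps (size α)} β∈)))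

  lin-ΦM-Homogeneous : ∀ Φ n G → Homogeneous n G → Homogeneous n (lin (ΦM Φ) G)
  lin-ΦM-Homogeneous Φ n [] [] = []
  lin-ΦM-Homogeneous Φ n ((q , α) ∷ G) (α∈ ∷ G-hom) =
    ++⁺ (map⁺ (map⁺ (All.tabulate (subst (λ k → _ ∈ comps k) (proj₁ (comps-size×IsComp n α∈))))))
        (lin-ΦM-Homogeneous Φ n G G-hom)

  sum-leq-single : ∀ n (f : List ℕ → ℚ) →
    sumℚ (map f (filterᵇ (λ β → leq β (single n)) (comps (size (single n))))) ≡ f (single n)
  sum-leq-single zero f = ℚ.+-identityʳ (f [])
  sum-leq-single (suc m) f rewrite +-identityʳ m | comps-suc m =
    begin
      sumℚ (map f (filterᵇ (λ β → leq β (single (suc m))) (map (co (suc m)) (sublists X))))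
    ≡⟨ sumℚ-filterᵇ (λ β → leq β (single (suc m))) f (map (co (suc m)) (sublists X)) ⟩
      sumℚ (map (λ β → if leq β (single (suc m)) then f β else 0ℚ) (map (co (suc m)) (sublists X)))
    ≡⟨ cong sumℚ (sym (map-∘ (sublists X))) ⟩
      sumℚ (map (λ T → if leq (co (suc m) T) (co (suc m) []) then f (co (suc m) T) else 0ℚ) (sublists X))
    ≡⟨ cong sumℚ (map-cong-local (All.map (λ {T} T⊆ → cong (λ b → if b then f (co (suc m) T) else 0ℚ)
                                                              (leq-co m T⊆ (minimum X)))
                                          (sublists-⊆ X))) ⟩
      sumℚ (map (λ T → if isSubset T [] then f (co (suc m) T) else 0ℚ) (sublists X))
    ≡⟨ only-[] X ⟩
      f (single (suc m)) + 0ℚ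
    ≡⟨ ℚ.+-identityʳ (f (single (suc m))) ⟩
      f (single (suc m))
    ∎
    where
    open ≡-Reasoning
    X = interval 1 m
    only-[] : ∀ Y → sumℚ (map (λ T → if isSubset T [] then f (co (suc m) T) else 0ℚ) (sublists Y)) ≡ f (single (suc m)) + 0ℚ
    only-[] [] = refl
    only-[] (y ∷ Y) = trans (cong sumℚ (map-++ _ (map (y ∷_) (sublists Y)) (sublists Y)))
      (trans (sumℚ-++ (map _ (map (y ∷_) (sublists Y))) _)
      (trans (cong₂ _+_ (sumℚ-zero _ (map⁺ (map⁺ (All.universal (λ _ → refl) (sublists Y))))) (only-[] Y))
             (+-identityˡ _)))

  private
    co-IsComp′ : ∀ n {S} → S ⊆ interval 1 (n ℕ.∸ 1) → IsComp (co n S)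
    co-IsComp′ zero _ = []
    co-IsComp′ (suc m) S⊆ = co-IsComp m S⊆

    size-co′ : ∀ n {S} → S ⊆ interval 1 (n ℕ.∸ 1) → size (co n S) ≡ n
    size-co′ zero _ = refl
    size-co′ (suc m) S⊆ = size-co m S⊆

    sum-binom-length-refinements′ : ∀ a n {S} → S ⊆ interval 1 (n ℕ.∸ 1) →
      sum (map (binom a ∘ length) (filterᵇ (leq (co n S)) (comps n))) ≡ binom (n ℕ.+ a ℕ.∸ length S ℕ.∸ 1) n
    sum-binom-length-refinements′ a zero [] = refl
    sum-binom-length-refinements′ a (suc m) {S} S⊆ =
      trans (sum-binom-length-refinements a m S⊆) (cong₂ binom top (+-comm m 1))
      where
      top : a ℕ.+ m ℕ.∸ length S ≡ suc m ℕ.+ a ℕ.∸ length S ℕ.∸ 1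
      top = sym (trans (∸-+-assoc (suc m ℕ.+ a) (length S) 1)
                (trans (cong (suc m ℕ.+ a ℕ.∸_) (+-comm (length S) 1)) (cong (ℕ._∸ length S) (+-comm m a))))

  D-IsComp : ∀ σ → IsComp (D σ)
  D-IsComp σ = co-IsComp′ (length σ) (descsFrom-⊆ 1 σ)

  size-D : ∀ σ → size (D σ) ≡ length σ
  size-D σ = size-co′ (length σ) (descsFrom-⊆ 1 σ)

  sum-binom-length-refinements-D : ∀ a σ →
    sum (map (binom a ∘ length) (filterᵇ (leq (D σ)) (comps (size (D σ))))) ≡ riffles a (length σ) (des σ)
  sum-binom-length-refinements-D a σ rewrite size-D σ =
    trans (sum-binom-length-refinements′ a (length σ) (descsFrom-⊆ 1 σ))
          (cong (λ k → binom (length σ ℕ.+ a ℕ.∸ k ℕ.∸ 1) (length σ)) (length-descsFrom 1 σ))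

  single-IsComp : ∀ n → IsComp (single n)
  single-IsComp zero = []
  single-IsComp (suc m) = s≤s z≤n ∷ []

  size-single : ∀ n → size (single n) ≡ n
  size-single zero = refl
  size-single (suc m) = +-identityʳ (suc m)

  F-IsComp : ∀ α → All (λ p → IsComp (proj₂ p)) (F α)
  F-IsComp α = All.map (λ β∈ → proj₂ (comps-size×IsComp (size α) β∈)) (F-Homogeneous α)

  module _ {a : ℕ} {Φ c : Mat} (isΨ : IsΨ a Φ) (isF : IsFMatrix Φ c) where

    c-single : ∀ α → IsComp α →
      c α (single (size α)) ≡ toℚ (sum (map (binom a ∘ length) (filterᵇ (leq α) (comps (size α)))))
    c-single α α-comp = begin
        c α (single (size α))
      ≡⟨ sum-leq-single (size α) (c α) ⟨
        sumℚ (map (c α) (filterᵇ (λ β → leq β (single (size α))) (comps (size (single (size α))))))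
      ≡⟨ isF α (single (size α)) α-comp (single-IsComp (size α)) (sym (size-single (size α))) ⟨
        coeff (single (size α)) (lin (ΦM Φ) (F α))
      ≡⟨ coeff-single≡ζ (size α) (lin (ΦM Φ) (F α)) (lin-ΦM-Homogeneous Φ (size α) (F α) (F-Homogeneous α)) ⟩
        ζ (lin (ΦM Φ) (F α))
      ≡⟨ isΨ (F α) (F-IsComp α) ⟩
        ζpow a (F α)
      ≡⟨ ζpow-F a α ⟩
        toℚ (sum (map (binom a ∘ length) (filterᵇ (leq α) (comps (size α)))))
      ∎
      where open ≡-Reasoning

    c-D-single : ∀ {n} σ → length σ ≡ n → c (D σ) (single n) ≡ toℚ (riffles a n (des σ))
    c-D-single σ refl = trans (cong (λ k → c (D σ) (single k)) (sym (size-D σ)))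
                              (trans (c-single (D σ) (D-IsComp σ)) (cong toℚ (sum-binom-length-refinements-D a σ)))

  evalF-D : ∀ a .{{_ : NonZero a}} {n} σ → length σ ≡ n →
    evalF (replicate a (+ 1 / a)) (D σ) ≡ (+ riffles a n (des σ) / a ^ n) {{m^n≢0 a n}}
  evalF-D a σ refl = begin
      evalF (replicate a (+ 1 / a)) (D σ)
    ≡⟨ evalF-replicate a (+ 1 / a) (D σ) ⟩
      toℚ (sum (map (binom a ∘ length) (filterᵇ (leq (D σ)) (comps (size (D σ)))))) * powℚ (+ 1 / a) (size (D σ))
    ≡⟨ cong₂ (λ k l → toℚ k * powℚ (+ 1 / a) l) (sum-binom-length-refinements-D a σ) (size-D σ) ⟩
      toℚ R * powℚ (+ 1 / a) (length σ)
    ≡⟨ *-comm (toℚ R) (powℚ (+ 1 / a) (length σ)) ⟩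
      powℚ (+ 1 / a) (length σ) * toℚ R
    ≡⟨ powℚ-1/-*-toℚ a (length σ) R ⟩
      (+ R / a ^ length σ) {{m^n≢0 a (length σ)}}
    ∎
    where
    open ≡-Reasoning
    R = riffles a (length σ) (des σ)

  probA-inv : ∀ a .{{_ : NonZero a}} {n π} → IsPerm n π →
    probA a (inv π) ≡ (+ riffles a n (des π) / a ^ n) {{m^n≢0 a n}}
  probA-inv a {n} {π} π-perm@(|π|≡n , _) =
    /-cong {{m^n≢0 a (length (inv π))}} {{m^n≢0 a n}}
      (cong +_ (trans (cong₂ (λ k e → (k ℕ.+ a ℕ.∸ e ℕ.∸ 1) C k) |π⁻¹|≡n d-π⁻¹⁻¹)
                      (sym (binom≡C (n ℕ.+ a ℕ.∸ des π ℕ.∸ 1) n))))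
      (cong (a ^_) |π⁻¹|≡n)
    where
    |π⁻¹|≡n = trans (length-inv π) |π|≡n
    d-π⁻¹⁻¹ : d (inv (inv π)) ≡ des π
    d-π⁻¹⁻¹ = trans (cong d (inv-involutive π-perm)) (length-descsFrom 1 π)

  c-D-single-perm : ∀ {a Φ c} → IsΨ a Φ → IsFMatrix Φ c → ∀ {n σ} → σ ∈ allPerms n →
    c (D σ) (single n) ≡ toℚ (riffles a n (des σ))
  c-D-single-perm isΨ isF {n} {σ} σ∈ = c-D-single isΨ isF σ (proj₁ (∈-allPerms⁻ {n} σ∈))

  sum-c-D-single : ∀ {a Φ c} → IsΨ (suc a) Φ → IsFMatrix Φ c → ∀ n →
    sumℚ (map (λ σ → c (D σ) (single n)) (allPerms n)) ≡ toℚ (suc a ^ n)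
  sum-c-D-single {a} {Φ} {c} isΨ isF n = begin
      sumℚ (map (λ σ → c (D σ) (single n)) (allPerms n))
    ≡⟨ cong sumℚ (map-cong-local (All.tabulate (c-D-single-perm isΨ isF {n}))) ⟩
      sumℚ (map (toℚ ∘ riffles (suc a) n ∘ des) (allPerms n))
    ≡⟨ trans (cong sumℚ (map-∘ (allPerms n))) (sumℚ-toℚ (map (riffles (suc a) n ∘ des) (allPerms n))) ⟩
      toℚ (sum (map (riffles (suc a) n ∘ des) (allPerms n)))
    ≡⟨ cong toℚ (sum-riffles a n) ⟩
      toℚ (suc a ^ n)
    ∎
    where open ≡-Reasoning

open import Defs
open import Data.Nat using (ℕ; NonZero; zero; suc; _^_; ≢-nonZero⁻¹)
open import Data.Nat.Properties using (m^n≢0)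
open import Data.Integer using (+_)
open import Data.List using (List; map; replicate)
open import Data.List.Membership.Propositional using (_∈_)
open import Data.Product using (_×_; _,_; proj₁)
open import Data.Rational using (0ℚ; _≤_; _*_; _/_)
open import Data.Empty using (⊥-elim)
open import Relation.Binary.PropositionalEquality using (_≡_; _≢_; refl; sym; trans; cong₂; subst; module ≡-Reasoning)
open NatToRational using (toℚ; toℚ-nonNeg; toℚ-injective; /-*-cancel)
open Descents using (des)
open Binomial using (riffles)
open Permutations using (∈-allPerms⁻)
open ShuffleCoefficients using (c-D-single-perm; sum-c-D-single; probA-inv; evalF-D)

proposition7p1 : (a : ℕ) → .{{_ : NonZero a}} → (n : ℕ) → (π : List ℕ) → π ∈ allPerms n →
    (Φ : Mat) → IsGradedHopfEndo Φ → IsΨ a Φ →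
    (c : Mat) → IsFMatrix Φ c →
    ((σ : List ℕ) → σ ∈ allPerms n → 0ℚ ≤ c (D σ) (single n))
    × (sumℚ (map (λ σ → c (D σ) (single n)) (allPerms n)) ≢ 0ℚ)
    × (c (D π) (single n) ≡ probA a (inv π) * sumℚ (map (λ σ → c (D σ) (single n)) (allPerms n)))
    × (probA a (inv π) ≡ evalF (replicate a (+ 1 / a)) (D π))
proposition7p1 zero {{0≢0}} = ⊥-elim (≢-nonZero⁻¹ 0 {{0≢0}} refl)
proposition7p1 (suc a) n π π∈ Φ _ isΨ c isF =
    (λ σ σ∈ → subst (0ℚ ≤_) (sym (c-D-single-perm isΨ isF {n} σ∈)) (toℚ-nonNeg (riffles (suc a) n (des σ))))
  , (λ Σ≡0 → ≢-nonZero⁻¹ (suc a ^ n) {{aⁿ≢0}} (toℚ-injective (trans (sym (sum-c-D-single isΨ isF n)) Σ≡0)))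
  , (begin
      c (D π) (single n)
    ≡⟨ c-D-single-perm isΨ isF {n} π∈ ⟩
      toℚ R
    ≡⟨ /-*-cancel R (suc a ^ n) {{aⁿ≢0}} ⟨
      (+ R / suc a ^ n) {{aⁿ≢0}} * toℚ (suc a ^ n)
    ≡⟨ cong₂ _*_ (probA-inv (suc a) π-perm) (sum-c-D-single isΨ isF n) ⟨
      probA (suc a) (inv π) * sumℚ (map (λ σ → c (D σ) (single n)) (allPerms n))
    ∎)
  , trans (probA-inv (suc a) π-perm) (sym (evalF-D (suc a) π (proj₁ π-perm)))
  where
  open ≡-Reasoning
  π-perm = ∈-allPerms⁻ {n} π∈
  R = riffles (suc a) n (des π)
  aⁿ≢0 = m^n≢0 (suc a) n
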